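{- Let $\Phi$ be an irreducible finite crystallographic root system and let $(D,d_+,d_-)$ be the bicomplex of cones of its cluster fan (see context). The spectral sequence of this bicomplex starting with $d_-$ (i.e. whose first page is the homology of $(D,d_-)$) degenerates at the second step.
   Context: Let $\{\alpha_i\}_{i\in I}$ be the simple roots and $\Phi_{\geq -1}=\Phi_{>0}\cup\{ -\alpha_i\}_{i\in I}$. Fomin–Zelevinsky compatibility: choose $I=I_+\sqcup I_-$ with nodes in each part pairwise non-adjacent; define $\tau_\varepsilon(\alpha)=\alpha$ if $\alpha=-\alpha_i$, $i\in I_{ -\varepsilon}$, and $\tau_\varepsilon(\alpha)=(\prod_{i\in I_\varepsilon}s_i)(\alpha)$ otherwise; the compatibility degree is the unique $\mathbb{Z}_{\ge0}$-valued function with $(-\alpha_i\|\beta)=\max([\beta:\alpha_i],0)$ and $(\tau_\varepsilon\alpha\|\tau_\varepsilon\beta)=(\alpha\|\beta)$; compatible means degree $0$. Cones of the fan $\Delta(\Phi)$ are the sets of pairwise compatible almost positive roots (including $\emptyset$). Let $D$ be the $\mathbb{Z}$-submodule of the unital exterior algebra over $\mathbb{Z}$ generated by the set $\Phi_{\geq -1}$ spanned by the monomials $\alpha_1\wedge\dots\wedge\alpha_k$ with $\{\alpha_1,\dots,\alpha_k\}$ a cone. The differential $d(\alpha_1\wedge\dots\wedge\alpha_k)=\sum_{j=1}^k(-1)^{j-1}\alpha_1\wedge\dots\wedge\widehat{\alpha_j}\wedge\dots\wedge\alpha_k$ splits as $d=d_++d_-$, where $d_+$ (resp. $d_-$) consists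 of the terms removing a positive root (resp. a negative simple root). Each of $d_+,d_-$ is a differential and $D$ is a bicomplex bigraded by (number of positive roots, number of negative simple roots). -}

module Defs where

open import Data.Nat using (ℕ; zero; suc)
import Data.Nat as ℕ
open import Data.Integer as ℤ using (ℤ; +_; -[1+_]; 0ℤ; 1ℤ; _+_; _-_; _*_; -_; _<_; _≤_; _≤?_)
open import Data.Fin using (Fin)
import Data.Fin as Fin
open import Data.Bool using (Bool; true; false; not; if_then_else_; _∧_)
import Data.Bool as Bool
open import Data.List as List using (List; []; _∷_; _++_; allFin; filter; length; concatMap)
open import Data.Bool.ListAction using (any)
open import Data.List.Relation.Unary.All using (All)
open import Data.List.Relation.Unary.AllPairs using (AllPairs)
open import Data.List.Relation.Unary.Linked using (Linked)
open import Data.Vec as Vec using (Vec; lookup; replicate; updateAt)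
import Data.Vec.Relation.Unary.All as VAll
import Data.Vec.Properties as VecP
import Data.List.Properties as ListP
open import Data.Product using (Σ; ∃; _×_; _,_; proj₁; proj₂)
open import Data.Sum using (_⊎_)
open import Relation.Nullary using (¬_; does)
open import Relation.Binary.PropositionalEquality using (_≡_; _≢_)

∑ : (n : ℕ) → (Fin n → ℤ) → ℤ
∑ n f = List.foldr (λ i acc → f i + acc) 0ℤ (allFin n)

-- Cartan matrices of finite type (= finite crystallographic root systems)
-- Convention (Kac): A i j = < alpha_i^vee , alpha_j >.

CartanMatrix : ℕ → Set
CartanMatrix n = Fin n → Fin n → ℤ

record IsFiniteTypeCartan (n : ℕ) (A : CartanMatrix n) : Set where
  field
    diag      : ∀ i → A i i ≡ + 2
    offdiag   : ∀ i j → i ≢ j → A i j ≤ 0ℤ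
    zero-sym  : ∀ i j → A i j ≡ 0ℤ → A j i ≡ 0ℤ
    sym       : Fin n → ℕ
    sym-pos   : ∀ i → 0 ℕ.< sym i
    sym-eq    : ∀ i j → (+ sym i) * A i j ≡ (+ sym j) * A j i
    pos-def   : ∀ (v : Fin n → ℤ) → (∃ λ i → v i ≢ 0ℤ) →
                0ℤ < ∑ n (λ i → ∑ n (λ j → v i * (+ sym i) * A i j * v j))

IsIndecomposable : (n : ℕ) → CartanMatrix n → Set
IsIndecomposable n A =
  ∀ (S : Fin n → Bool) → (∃ λ i → S i ≡ true) → (∃ λ j → S j ≡ false) →
  Σ (Fin n) λ i → Σ (Fin n) λ j → S i ≡ true × S j ≡ false × A i j ≢ 0ℤ

-- Roots, in coordinates w.r.t. the simple roots

Root : ℕ → Set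
Root n = Vec ℤ n

simple : ∀ {n} → Fin n → Root n
simple {n} i = updateAt (replicate n 0ℤ) i (λ _ → 1ℤ)

negSimple : ∀ {n} → Fin n → Root n
negSimple {n} i = updateAt (replicate n 0ℤ) i (λ _ → -[1+ 0 ])

refl : ∀ {n} → CartanMatrix n → Fin n → Root n → Root n
refl {n} A i v = updateAt v i (λ x → x - ∑ n (λ j → A i j * lookup v j))

data IsRoot {n : ℕ} (A : CartanMatrix n) : Root n → Set where
  simple-root : ∀ j → IsRoot A (simple j)
  refl-root   : ∀ i {v} → IsRoot A v → IsRoot A (refl A i v)

IsPositiveRoot : ∀ {n} → CartanMatrix n → Root n → Set
IsPositiveRoot A v = IsRoot A v × VAll.All (0ℤ ≤_) v

IsAlmostPositive : ∀ {n} → CartanMatrix n → Root n → Set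
IsAlmostPositive A v = IsPositiveRoot A v ⊎ (∃ λ i → v ≡ negSimple i)

-- Bipartition and τ_ε.  ε i ≡ true means i ∈ I_+ ; b : Bool encodes the sign ε.

IsBipartition : ∀ {n} → CartanMatrix n → (Fin n → Bool) → Set
IsBipartition A ε = ∀ i j → i ≢ j → A i j ≢ 0ℤ → ε i ≢ ε j

_≟R_ : ∀ {n} (u v : Root n) → Relation.Nullary.Dec (u ≡ v)
_≟R_ = VecP.≡-dec ℤ._≟_

-- product of the s_i, i ∈ I_b (these commute)
prodRefl : ∀ {n} → CartanMatrix n → (Fin n → Bool) → Bool → Root n → Root n
prodRefl {n} A ε b v =
  List.foldr (λ i w → if does (ε i Bool.≟ b) then refl A i w else w) v (allFin n)

isFixedNeg : ∀ {n} → (Fin n → Bool) → Bool → Root n → Bool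
isFixedNeg {n} ε b v = any (λ i → does (ε i Bool.≟ not b) ∧ does (v ≟R negSimple i)) (allFin n)

tau : ∀ {n} → CartanMatrix n → (Fin n → Bool) → Bool → Root n → Root n
tau A ε b v = if isFixedNeg ε b v then v else prodRefl A ε b v

clamp : ℤ → ℕ
clamp (+ k)     = k
clamp -[1+ _ ]  = 0

-- c is the Fomin–Zelevinsky compatibility degree (characterised by these
-- two properties on Φ_{≥ -1})
IsCompatibilityDegree : ∀ {n} → CartanMatrix n → (Fin n → Bool) →
                        (Root n → Root n → ℕ) → Set
IsCompatibilityDegree A ε c =
  (∀ i β → IsAlmostPositive A β → c (negSimple i) β ≡ clamp (lookup β i)) ×
  (∀ b α β → IsAlmostPositive A α → IsAlmostPositive A β →
     c (tau A ε b α) (tau A ε b β) ≡ c α β)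

-- Cones, represented as strictly increasing lists (for a fixed total order)

lexLT : ∀ {n} → Root n → Root n → Set
lexLT Vec.[] Vec.[] = Data.Empty.⊥
  where import Data.Empty
lexLT (x Vec.∷ u) (y Vec.∷ v) = x < y ⊎ (x ≡ y × lexLT u v)

IsCone : ∀ {n} → CartanMatrix n → (Root n → Root n → ℕ) → List (Root n) → Set
IsCone A c l =
  All (IsAlmostPositive A) l ×
  Linked lexLT l ×
  AllPairs (λ α β → c α β ≡ 0 × c β α ≡ 0) l

-- The complex D: elements are finite formal Z-combinations of cones
-- (a list of (coefficient, cone)); equality is coefficientwise.

Chain : ℕ → Set
Chain n = List (ℤ × List (Root n))

IsChain : ∀ {n} → CartanMatrix n → (Root n → Root n → ℕ) → Chain n → Set
IsChain A c x = All (λ p → IsCone A c (proj₂ p)) x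

coeff : ∀ {n} → Chain n → List (Root n) → ℤ
coeff [] l = 0ℤ
coeff ((k , m) ∷ x) l = (if does (ListP.≡-dec _≟R_ m l) then k else 0ℤ) + coeff x l

_≈_ : ∀ {n} → Chain n → Chain n → Set
x ≈ y = ∀ l → coeff x l ≡ coeff y l

-- differential of a monomial α_1 ∧ … ∧ α_k
dMono : ∀ {n} → List (Root n) → Chain n
dMono [] = []
dMono (a ∷ l) = (1ℤ , l) ∷ List.map (λ p → (- proj₁ p , a ∷ proj₂ p)) (dMono l)

-- total differential d = d_+ + d_-
d : ∀ {n} → Chain n → Chain n
d x = concatMap (λ p → List.map (λ q → (proj₁ p * proj₁ q , proj₂ q)) (dMono (proj₂ p))) x

-- Filtration by the number of positive roots (columns); d_- preserves it,
-- d_+ lowers it by one, so the associated spectral sequence has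
-- d_0 = d_- and E_1 = H(D, d_-).

nonNeg : ∀ {n} → Root n → Bool
nonNeg Vec.[] = true
nonNeg (x Vec.∷ v) = does (0ℤ ≤? x) ∧ nonNeg v

posCount : ∀ {n} → List (Root n) → ℕ
posCount l = length (filter (λ v → Bool.T? (nonNeg v)) l)

InF : ∀ {n} → ℤ → Chain n → Set
InF p x = ∀ l → coeff x l ≢ 0ℤ → + posCount l ≤ p

Z : ∀ {n} → CartanMatrix n → (Root n → Root n → ℕ) → ℕ → ℤ → Chain n → Set
Z A c r p x = IsChain A c x × InF p x × InF (p - + r) (d x)

-- E_r^p = Z_r^p / (Z_{r-1}^{p-1} + d Z_{r-1}^{p+r-1}),  d_r : E_r^p → E_r^{p-r}
-- induced by d.  d_r = 0 iff for every x ∈ Z_r^p,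
--   d x ∈ Z_{r-1}^{p-r-1} + d Z_{r-1}^{p-1}.
DrVanishes : ∀ {n} → CartanMatrix n → (Root n → Root n → ℕ) → ℕ → Set
DrVanishes A c r =
  ∀ (p : ℤ) (x : Chain _) → Z A c r p x →
    Σ (Chain _) λ y → Σ (Chain _) λ z →
      Z A c (r ℕ.∸ 1) (p - + r - 1ℤ) y ×
      Z A c (r ℕ.∸ 1) (p - 1ℤ) z ×
      (d x ≈ (y ++ d z))

DegeneratesAtE2 : ∀ {n} → CartanMatrix n → (Root n → Root n → ℕ) → Set
DegeneratesAtE2 A c = ∀ r → 2 ℕ.≤ r → DrVanishes A c r

-- Fix a set Π of positive roots. The negative simple roots are pairwise compatible, so the
-- cones with positive part Π are the sets Π ∪ S with S ⊆ N(Π), the negative simple roots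
-- compatible with every root of Π, and on them d₋ is the augmented boundary of the full simplex
-- on N(Π). If N(Π) is nonempty, wedging with its first element is a contracting homotopy h:
-- d₋h + hd₋ = 1 − π, where π keeps the purely positive cones with N(Π) empty.
-- Let x ∈ F_p with dx ∈ F_{p−2}. Its top column w₀ has d₋w₀ = 0 and πd₊w₀ = 0, so the zig-zag
-- w_{k+1} = −h d₊ w_k (whose cones all contain a negative root, hence are never seen by π)
-- sums to a cycle w₀ + w₁ + ⋯ with w₁ + w₂ + ⋯ ∈ F_{p−1}. Thus x is a cycle plus an element of
-- F_{p−1}, which says that d_r vanishes on E_r^p for every r ≥ 2.
-- Of the hypotheses only the normalisation c(−α_i, β) = [β : α_i]₊ is used, to see that the
-- negative simple roots are pairwise compatible.

module Submission where

open import Defs hiding (refl)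

open import Data.Bool using (Bool; true; false; not; if_then_else_; T?)
open import Data.Empty using (⊥-elim)
open import Data.Fin using (Fin; zero; suc)
open import Data.Integer as ℤ using (ℤ; +_; 0ℤ; 1ℤ; _+_; _-_; _*_; -_)
import Data.Integer.Properties as ℤP
open import Data.Integer.Tactic.RingSolver using (solve-∀)
open import Data.List as List using (List; []; _∷_; _++_; length; allFin)
import Data.List.Properties as ListP
open import Data.List.Membership.Propositional using (lose)
open import Data.List.Membership.Propositional.Properties using (∈-allFin)
open import Data.List.Relation.Binary.Permutation.Propositional using (_↭_; ↭-refl; ↭-sym; ↭-trans; ↭-prep; ↭-swap; ↭⇒↭ₛ)
open import Data.List.Relation.Binary.Permutation.Propositional.Properties using (All-resp-↭; Any-resp-↭; ↭-length; filter-↭)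
import Data.List.Relation.Binary.Permutation.Setoid.Properties as PermutationSetoid
open import Data.List.Relation.Unary.All as All using (All; []; _∷_; all?)
import Data.List.Relation.Unary.All.Properties as AllP
open import Data.List.Relation.Unary.AllPairs using (AllPairs; []; _∷_)
open import Data.List.Relation.Unary.Any using (Any; here; there; any?; satisfied)
open import Data.List.Relation.Unary.Linked using (Linked; []; [-]; _∷_)
open import Data.List.Relation.Unary.Linked.Properties using (AllPairs⇒Linked; Linked⇒AllPairs)
open import Data.Nat as ℕ using (ℕ; zero; suc; _≤_; z≤n; s≤s)
import Data.Nat.Properties as ℕP
open import Data.Product using (Σ; _×_; _,_; proj₁; proj₂; uncurry)
open import Data.Sum using (inj₁; inj₂)
import Data.Vec as Vec
import Data.Vec.Properties as VecP
import Data.Vec.Relation.Unary.All as VAll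
open import Function using (_∘_; id)
open import Relation.Binary.Bundles using (Setoid)
open import Relation.Binary.Definitions using (DecidableEquality; Trichotomous; Symmetric; tri<; tri≈; tri>)
open import Relation.Binary.PropositionalEquality using (_≡_; _≢_; refl; sym; trans; cong; cong₂; subst; module ≡-Reasoning)
import Relation.Binary.PropositionalEquality as ≡
import Relation.Binary.Reasoning.Setoid as SetoidReasoning
open import Relation.Nullary using (¬_; Dec; does; yes; no)
import Relation.Nullary.Decidable as Dec
open import Relation.Nullary.Decidable using (_×-dec_)

private
  variable
    n : ℕ

-- Chains as formal ℤ-combinations of monomials

Mono : ℕ → Set
Mono n = List (Root n)

_≟M_ : DecidableEquality (Mono n)
_≟M_ = ListP.≡-dec _≟R_

⟦_⟧ : Mono n → Chain n
⟦ m ⟧ = (1ℤ , m) ∷ []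

neg : Chain n → Chain n
neg = List.map (λ q → (- proj₁ q , proj₂ q))

scale : ℤ → ℤ × Mono n → ℤ × Mono n
scale k q = (k * proj₁ q , proj₂ q)

extend : (Mono n → Chain n) → Chain n → Chain n
extend f = List.concatMap (λ p → List.map (scale (proj₁ p)) (f (proj₂ p)))

-- Identities between chains are proved by pairing both sides with every g (≋-by-pairing).
pairing : (Mono n → ℤ) → Chain n → ℤ
pairing g [] = 0ℤ
pairing g ((k , m) ∷ x) = k * g m + pairing g x

indicator : Mono n → Mono n → ℤ
indicator l m = if does (m ≟M l) then 1ℤ else 0ℤ

coeff≡pairing-indicator : ∀ (x : Chain n) l → coeff x l ≡ pairing (indicator l) x
coeff≡pairing-indicator [] l = refl
coeff≡pairing-indicator ((k , m) ∷ x) l =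
  cong₂ _+_ (sym (*-indicator (does (m ≟M l)))) (coeff≡pairing-indicator x l)
  where
  *-indicator : ∀ b → k * (if b then 1ℤ else 0ℤ) ≡ (if b then k else 0ℤ)
  *-indicator true  = ℤP.*-identityʳ k
  *-indicator false = ℤP.*-zeroʳ k

pairing-++ : ∀ (g : Mono n → ℤ) x y → pairing g (x ++ y) ≡ pairing g x + pairing g y
pairing-++ g [] y = sym (ℤP.+-identityˡ _)
pairing-++ g ((k , m) ∷ x) y =
  trans (cong (_+_ (k * g m)) (pairing-++ g x y)) (sym (ℤP.+-assoc (k * g m) _ _))

pairing-scale : ∀ (g : Mono n → ℤ) k y → pairing g (List.map (scale k) y) ≡ k * pairing g y
pairing-scale g k [] = sym (ℤP.*-zeroʳ k)
pairing-scale g k ((j , m) ∷ y) =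
  trans (cong (_+_ ((k * j) * g m)) (pairing-scale g k y)) (distrib k j (g m) (pairing g y))
  where
  distrib : ∀ k j a b → (k * j) * a + k * b ≡ k * (j * a + b)
  distrib = solve-∀

pairing-extend : ∀ (g : Mono n → ℤ) f x →
                 pairing g (extend f x) ≡ pairing (λ m → pairing g (f m)) x
pairing-extend g f [] = refl
pairing-extend g f ((k , m) ∷ x) =
  trans (pairing-++ g (List.map (scale k) (f m)) (extend f x))
        (cong₂ _+_ (pairing-scale g k (f m)) (pairing-extend g f x))

pairing-neg : ∀ (g : Mono n → ℤ) x → pairing g (neg x) ≡ - pairing g x
pairing-neg g [] = refl
pairing-neg g ((k , m) ∷ x) =
  trans (cong (_+_ ((- k) * g m)) (pairing-neg g x)) (negate k (g m) (pairing g x))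
  where
  negate : ∀ k a b → (- k) * a + - b ≡ - (k * a + b)
  negate = solve-∀

pairing-cong-on : ∀ {g h : Mono n → ℤ} x → All (λ q → g (proj₂ q) ≡ h (proj₂ q)) x →
               pairing g x ≡ pairing h x
pairing-cong-on [] [] = refl
pairing-cong-on ((k , m) ∷ x) (e ∷ es) = cong₂ _+_ (cong (k *_) e) (pairing-cong-on x es)

pairing-cong : ∀ {g h : Mono n → ℤ} x → (∀ m → g m ≡ h m) → pairing g x ≡ pairing h x
pairing-cong x e = pairing-cong-on x (All.universal (λ q → e (proj₂ q)) x)

pairing-+ : ∀ (g h : Mono n → ℤ) x → pairing (λ m → g m + h m) x ≡ pairing g x + pairing h x
pairing-+ g h [] = refl
pairing-+ g h ((k , m) ∷ x) =
  trans (cong (_+_ (k * (g m + h m))) (pairing-+ g h x))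
        (distrib k (g m) (h m) (pairing g x) (pairing h x))
  where
  distrib : ∀ k a b c e → k * (a + b) + (c + e) ≡ (k * a + c) + (k * b + e)
  distrib = solve-∀

pairing-- : ∀ (g : Mono n → ℤ) x → pairing (λ m → - g m) x ≡ - pairing g x
pairing-- g [] = refl
pairing-- g ((k , m) ∷ x) =
  trans (cong (_+_ (k * (- g m))) (pairing-- g x)) (negate k (g m) (pairing g x))
  where
  negate : ∀ k a b → k * (- a) + - b ≡ - (k * a + b)
  negate = solve-∀

pairing-0 : ∀ (x : Chain n) → pairing (λ _ → 0ℤ) x ≡ 0ℤ
pairing-0 []            = refl
pairing-0 ((k , m) ∷ x) = trans (cong₂ _+_ (ℤP.*-zeroʳ k) (pairing-0 x)) refl

coeff-++ : ∀ (x y : Chain n) l → coeff (x ++ y) l ≡ coeff x l + coeff y l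
coeff-++ x y l = begin
  coeff (x ++ y) l                                   ≡⟨ coeff≡pairing-indicator (x ++ y) l ⟩
  pairing (indicator l) (x ++ y)                     ≡⟨ pairing-++ (indicator l) x y ⟩
  pairing (indicator l) x + pairing (indicator l) y  ≡⟨ cong₂ _+_ (coeff≡pairing-indicator x l)
                                                                  (coeff≡pairing-indicator y l) ⟨
  coeff x l + coeff y l                              ∎
  where open ≡-Reasoning

coeff-neg : ∀ (x : Chain n) l → coeff (neg x) l ≡ - coeff x l
coeff-neg x l = begin
  coeff (neg x) l                ≡⟨ coeff≡pairing-indicator (neg x) l ⟩
  pairing (indicator l) (neg x)  ≡⟨ pairing-neg (indicator l) x ⟩
  - pairing (indicator l) x      ≡⟨ cong -_ (coeff≡pairing-indicator x l) ⟨
  - coeff x l                    ∎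
  where open ≡-Reasoning

indicator-≢ : ∀ {l m : Mono n} → m ≢ l → indicator l m ≡ 0ℤ
indicator-≢ {l = l} {m} m≢l with m ≟M l
... | yes m≡l = ⊥-elim (m≢l m≡l)
... | no _    = refl

coeff-absent : ∀ (y : Chain n) l → All (λ e → proj₂ e ≢ l) y → coeff y l ≡ 0ℤ
coeff-absent y l absent = begin
  coeff y l                ≡⟨ coeff≡pairing-indicator y l ⟩
  pairing (indicator l) y  ≡⟨ pairing-cong-on y (All.map indicator-≢ absent) ⟩
  pairing (λ _ → 0ℤ) y     ≡⟨ pairing-0 y ⟩
  0ℤ                       ∎
  where open ≡-Reasoning

without : Mono n → Chain n → Chain n
without l [] = []
without l ((k , m) ∷ x) = if does (m ≟M l) then without l x else (k , m) ∷ without l x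

length-without : ∀ l (x : Chain n) → length (without l x) ≤ length x
length-without l [] = z≤n
length-without l ((k , m) ∷ x) with m ≟M l
... | yes _ = ℕP.m≤n⇒m≤1+n (length-without l x)
... | no _  = s≤s (length-without l x)

without-head : ∀ k m (x : Chain n) → without m ((k , m) ∷ x) ≡ without m x
without-head k m x with m ≟M m
... | yes _  = refl
... | no m≢m = ⊥-elim (m≢m refl)

coeff-without-self : ∀ (x : Chain n) l → coeff (without l x) l ≡ 0ℤ
coeff-without-self [] l = refl
coeff-without-self ((k , m) ∷ x) l with m ≟M l
... | yes _  = coeff-without-self x l
... | no m≢l with m ≟M l
...   | yes m≡l = ⊥-elim (m≢l m≡l)
...   | no _    = trans (ℤP.+-identityˡ _) (coeff-without-self x l)

coeff-without-other : ∀ (x : Chain n) {l l′} → l′ ≢ l → coeff (without l x) l′ ≡ coeff x l′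
coeff-without-other [] l′≢l = refl
coeff-without-other ((k , m) ∷ x) {l} {l′} l′≢l with m ≟M l
... | no _ = cong (_+_ (if does (m ≟M l′) then k else 0ℤ)) (coeff-without-other x l′≢l)
... | yes refl with m ≟M l′
...   | yes refl = ⊥-elim (l′≢l refl)
...   | no _     = trans (coeff-without-other x l′≢l) (sym (ℤP.+-identityˡ _))

pairing-without : ∀ (g : Mono n → ℤ) x l → pairing g x ≡ coeff x l * g l + pairing g (without l x)
pairing-without g [] l = sym (ℤP.*-zeroˡ (g l))
pairing-without g ((k , m) ∷ x) l with m ≟M l
... | yes refl =
  trans (cong (_+_ (k * g m)) (pairing-without g x m)) (regroup k (coeff x m) (g m) _)
  where
  regroup : ∀ k c a b → k * a + (c * a + b) ≡ (k + c) * a + b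
  regroup = solve-∀
... | no _ =
  trans (cong (_+_ (k * g m)) (pairing-without g x l)) (regroup k (coeff x l) (g m) (g l) _)
  where
  regroup : ∀ k c a e b → k * a + (c * e + b) ≡ (0ℤ + c) * e + (k * a + b)
  regroup = solve-∀

pairing-vanishes : ∀ (g : Mono n → ℤ) x → x ≈ [] → pairing g x ≡ 0ℤ
pairing-vanishes g x = go (length x) x ℕP.≤-refl
  where
  go : ∀ N x → length x ≤ N → x ≈ [] → pairing g x ≡ 0ℤ
  go _ [] _ _ = refl
  go (suc N) x@((k , m) ∷ x′) (s≤s len) x≈0 = begin
    pairing g x                                ≡⟨ pairing-without g x m ⟩
    coeff x m * g m + pairing g (without m x)  ≡⟨ cong₂ _+_ (cong (_* g m) (x≈0 m)) (go N (without m x) shorter rest≈0) ⟩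
    0ℤ * g m + 0ℤ                              ≡⟨ cong (_+ 0ℤ) (ℤP.*-zeroˡ (g m)) ⟩
    0ℤ                                         ∎
    where
    open ≡-Reasoning
    shorter : length (without m x) ≤ N
    shorter rewrite without-head k m x′ = ℕP.≤-trans (length-without m x′) len
    rest≈0 : without m x ≈ []
    rest≈0 l with l ≟M m
    ... | yes refl = coeff-without-self x m
    ... | no l≢m   = trans (coeff-without-other x l≢m) (x≈0 l)

record _≋_ (x y : Chain n) : Set where
  constructor mk≋
  field
    coeff-≡ : x ≈ y

open _≋_ public
infix 4 _≋_

≋-setoid : ℕ → Setoid _ _
≋-setoid n = record
  { Carrier       = Chain n
  ; _≈_           = _≋_
  ; isEquivalence = record
    { refl  = mk≋ (λ _ → refl)
    ; sym   = λ x≋y → mk≋ (λ l → sym (coeff-≡ x≋y l))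
    ; trans = λ x≋y y≋z → mk≋ (λ l → trans (coeff-≡ x≋y l) (coeff-≡ y≋z l))
    }
  }

module ≋-Reasoning {n : ℕ} = SetoidReasoning (≋-setoid n)

module _ {n : ℕ} where
  open Setoid (≋-setoid n) public
    using () renaming (refl to ≋-refl; sym to ≋-sym; trans to ≋-trans; reflexive to ≡⇒≋)

≋-by-pairing : {x y : Chain n} → (∀ g → pairing g x ≡ pairing g y) → x ≋ y
≋-by-pairing {x = x} {y} e = mk≋ λ l → begin
  coeff x l                ≡⟨ coeff≡pairing-indicator x l ⟩
  pairing (indicator l) x  ≡⟨ e (indicator l) ⟩
  pairing (indicator l) y  ≡⟨ coeff≡pairing-indicator y l ⟨
  coeff y l                ∎
  where open ≡-Reasoning

pairing-resp : ∀ (g : Mono n → ℤ) {x y} → x ≋ y → pairing g x ≡ pairing g y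
pairing-resp g {x} {y} x≋y = ℤP.i-j≡0⇒i≡j _ _ (begin
  pairing g x - pairing g y         ≡⟨ cong (_+_ (pairing g x)) (pairing-neg g y) ⟨
  pairing g x + pairing g (neg y)   ≡⟨ pairing-++ g x (neg y) ⟨
  pairing g (x ++ neg y)            ≡⟨ pairing-vanishes g (x ++ neg y) difference≈0 ⟩
  0ℤ                                ∎)
  where
  open ≡-Reasoning
  difference≈0 : (x ++ neg y) ≈ []
  difference≈0 l = begin
    coeff (x ++ neg y) l                            ≡⟨ coeff-++ x (neg y) l ⟩
    coeff x l + coeff (neg y) l                     ≡⟨ cong₂ _+_ (coeff-≡ x≋y l) (coeff-neg y l) ⟩
    coeff y l - coeff y l                           ≡⟨ ℤP.+-inverseʳ (coeff y l) ⟩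
    0ℤ                                              ∎

++-cong : {x x′ y y′ : Chain n} → x ≋ x′ → y ≋ y′ → x ++ y ≋ x′ ++ y′
++-cong {x = x} {x′} {y} {y′} x≋x′ y≋y′ = ≋-by-pairing λ g →
  trans (pairing-++ g x y)
        (trans (cong₂ _+_ (pairing-resp g x≋x′) (pairing-resp g y≋y′)) (sym (pairing-++ g x′ y′)))

++-congˡ : ∀ (x : Chain n) {y y′} → y ≋ y′ → x ++ y ≋ x ++ y′
++-congˡ x y≋y′ = ++-cong (≋-refl {x = x}) y≋y′

neg-cong : {x y : Chain n} → x ≋ y → neg x ≋ neg y
neg-cong {x = x} {y} x≋y = ≋-by-pairing λ g →
  trans (pairing-neg g x) (trans (cong -_ (pairing-resp g x≋y)) (sym (pairing-neg g y)))

++-comm : (x y : Chain n) → x ++ y ≋ y ++ x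
++-comm x y = ≋-by-pairing λ g →
  trans (pairing-++ g x y) (trans (ℤP.+-comm (pairing g x) (pairing g y)) (sym (pairing-++ g y x)))

++-inverseʳ : (x : Chain n) → x ++ neg x ≋ []
++-inverseʳ x = ≋-by-pairing λ g →
  trans (pairing-++ g x (neg x)) (trans (cong (_+_ (pairing g x)) (pairing-neg g x)) (ℤP.+-inverseʳ (pairing g x)))

++-identityʳ : (x : Chain n) → x ++ [] ≋ x
++-identityʳ x = ≡⇒≋ (ListP.++-identityʳ x)

++-cancel-neg : ∀ (u v : Chain n) → u ++ (v ++ neg u) ≋ v
++-cancel-neg u v = ≋-by-pairing λ g → begin
  pairing g (u ++ (v ++ neg u))                    ≡⟨ pairing-++ g u (v ++ neg u) ⟩
  pairing g u + pairing g (v ++ neg u)             ≡⟨ cong (_+_ (pairing g u)) (pairing-++ g v (neg u)) ⟩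
  pairing g u + (pairing g v + pairing g (neg u))  ≡⟨ cong (λ a → pairing g u + (pairing g v + a)) (pairing-neg g u) ⟩
  pairing g u + (pairing g v - pairing g u)        ≡⟨ cancel (pairing g u) (pairing g v) ⟩
  pairing g v                                      ∎
  where
  open ≡-Reasoning
  cancel : ∀ a b → a + (b - a) ≡ b
  cancel = solve-∀

≋-[]-of-sum : {x y : Chain n} → x ≋ [] → x ++ y ≋ [] → y ≋ []
≋-[]-of-sum {y = y} x≋[] x+y≋[] = ≋-trans (++-cong (≋-sym x≋[]) (≋-refl {x = y})) x+y≋[]

≋-neg-of-sum : {x y : Chain n} → x ++ y ≋ [] → x ≋ neg y
≋-neg-of-sum {x = x} {y} x+y≋0 = ≋-by-pairing λ g → begin
  pairing g x                          ≡⟨ cancel (pairing g x) (pairing g y) ⟩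
  (pairing g x + pairing g y) - pairing g y  ≡⟨ cong (_- pairing g y) (pairing-++ g x y) ⟨
  pairing g (x ++ y) - pairing g y     ≡⟨ cong (_- pairing g y) (pairing-resp g x+y≋0) ⟩
  0ℤ - pairing g y                     ≡⟨ ℤP.+-identityˡ _ ⟩
  - pairing g y                        ≡⟨ pairing-neg g y ⟨
  pairing g (neg y)                    ∎
  where
  open ≡-Reasoning
  cancel : ∀ a b → a ≡ (a + b) - b
  cancel = solve-∀

≋-[]-of-double : {x : Chain n} → x ++ x ≋ [] → x ≋ []
≋-[]-of-double {x = x} x+x≋0 = mk≋ λ l → ℤP.*-cancelˡ-≡ (+ 2) (coeff x l) 0ℤ (begin
  + 2 * coeff x l                ≡⟨ double (coeff x l) ⟩
  coeff x l + coeff x l          ≡⟨ sym (coeff-++ x x l) ⟩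
  coeff (x ++ x) l               ≡⟨ coeff-≡ x+x≋0 l ⟩
  0ℤ                             ≡⟨ ℤP.*-zeroʳ (+ 2) ⟨
  + 2 * 0ℤ                       ∎)
  where
  open ≡-Reasoning
  double : ∀ a → + 2 * a ≡ a + a
  double = solve-∀

extend-resp : ∀ (f : Mono n → Chain n) {x y} → x ≋ y → extend f x ≋ extend f y
extend-resp f {x} {y} x≋y = ≋-by-pairing λ g →
  trans (pairing-extend g f x) (trans (pairing-resp _ x≋y) (sym (pairing-extend g f y)))

extend-cong-on : ∀ {f f′ : Mono n → Chain n} x → All (λ q → f (proj₂ q) ≋ f′ (proj₂ q)) x →
              extend f x ≋ extend f′ x
extend-cong-on {f = f} {f′} x f≋f′ = ≋-by-pairing λ g →
  trans (pairing-extend g f x)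
        (trans (pairing-cong-on x (All.map (pairing-resp g) f≋f′)) (sym (pairing-extend g f′ x)))

extend-cong : ∀ {f f′ : Mono n → Chain n} x → (∀ m → f m ≋ f′ m) → extend f x ≋ extend f′ x
extend-cong x f≋f′ = extend-cong-on x (All.universal (λ q → f≋f′ (proj₂ q)) x)

extend-∘ : ∀ (f g : Mono n → Chain n) x → extend f (extend g x) ≋ extend (λ m → extend f (g m)) x
extend-∘ f g x = ≋-by-pairing λ h → begin
  pairing h (extend f (extend g x))                          ≡⟨ pairing-extend h f (extend g x) ⟩
  pairing (λ m → pairing h (f m)) (extend g x)               ≡⟨ pairing-extend _ g x ⟩
  pairing (λ m → pairing (λ m′ → pairing h (f m′)) (g m)) x  ≡⟨ pairing-cong x (λ m → pairing-extend h f (g m)) ⟨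
  pairing (λ m → pairing h (extend f (g m))) x               ≡⟨ pairing-extend h _ x ⟨
  pairing h (extend (λ m → extend f (g m)) x)                ∎
  where open ≡-Reasoning

extend-++ : ∀ (f : Mono n → Chain n) x y → extend f (x ++ y) ≡ extend f x ++ extend f y
extend-++ f [] y = refl
extend-++ f ((k , m) ∷ x) y =
  trans (cong (List.map (scale k) (f m) ++_) (extend-++ f x y))
        (sym (ListP.++-assoc (List.map (scale k) (f m)) (extend f x) (extend f y)))

extend-+ : ∀ (f g : Mono n → Chain n) x → extend (λ m → f m ++ g m) x ≋ extend f x ++ extend g x
extend-+ f g x = ≋-by-pairing λ h → begin
  pairing h (extend (λ m → f m ++ g m) x)                        ≡⟨ pairing-extend h _ x ⟩
  pairing (λ m → pairing h (f m ++ g m)) x                       ≡⟨ pairing-cong x (λ m → pairing-++ h (f m) (g m)) ⟩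
  pairing (λ m → pairing h (f m) + pairing h (g m)) x            ≡⟨ pairing-+ _ _ x ⟩
  pairing (λ m → pairing h (f m)) x + pairing (λ m → pairing h (g m)) x
    ≡⟨ cong₂ _+_ (pairing-extend h f x) (pairing-extend h g x) ⟨
  pairing h (extend f x) + pairing h (extend g x)                ≡⟨ pairing-++ h (extend f x) (extend g x) ⟨
  pairing h (extend f x ++ extend g x)                           ∎
  where open ≡-Reasoning

extend-neg : ∀ (f : Mono n → Chain n) x → extend f (neg x) ≋ neg (extend f x)
extend-neg f x = ≋-by-pairing λ g → begin
  pairing g (extend f (neg x))             ≡⟨ pairing-extend g f (neg x) ⟩
  pairing (λ m → pairing g (f m)) (neg x)  ≡⟨ pairing-neg _ x ⟩
  - pairing (λ m → pairing g (f m)) x      ≡⟨ cong -_ (pairing-extend g f x) ⟨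
  - pairing g (extend f x)                 ≡⟨ pairing-neg g (extend f x) ⟨
  pairing g (neg (extend f x))             ∎
  where open ≡-Reasoning

extend-const-[] : ∀ (x : Chain n) → extend (λ _ → []) x ≡ []
extend-const-[] [] = refl
extend-const-[] (_ ∷ x) = extend-const-[] x

extend-⟦⟧ : ∀ (x : Chain n) → extend ⟦_⟧ x ≋ x
extend-⟦⟧ x = ≋-by-pairing λ g →
  trans (pairing-extend g ⟦_⟧ x) (pairing-cong x (λ m → trans (ℤP.+-identityʳ (1ℤ * g m)) (ℤP.*-identityˡ (g m))))

extend-single : ∀ (f : Mono n → Chain n) m → extend f ⟦ m ⟧ ≋ f m
extend-single f m = ≋-by-pairing λ g →
  trans (pairing-extend g f ⟦ m ⟧) (trans (ℤP.+-identityʳ _) (ℤP.*-identityˡ _))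

All-extend : ∀ {Q : Mono n → Set} (f : Mono n → Chain n) x →
             All (λ p → All (Q ∘ proj₂) (f (proj₂ p))) x → All (Q ∘ proj₂) (extend f x)
All-extend f []            []       = []
All-extend f ((k , m) ∷ x) (q ∷ qs) = AllP.++⁺ (AllP.map⁺ (All.map id q)) (All-extend f x qs)

All-neg : ∀ {Q : Mono n → Set} {x} → All (Q ∘ proj₂) x → All (Q ∘ proj₂) (neg x)
All-neg qs = AllP.map⁺ (All.map id qs)

onlyIf : Bool → Chain n → Chain n
onlyIf true  z = z
onlyIf false z = []

extend-onlyIf : ∀ (f : Mono n → Chain n) b z → extend f (onlyIf b z) ≡ onlyIf b (extend f z)
extend-onlyIf f true  z = refl
extend-onlyIf f false z = refl

onlyIf-cong : ∀ b {z z′ : Chain n} → z ≋ z′ → onlyIf b z ≋ onlyIf b z′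
onlyIf-cong true  z≋z′ = z≋z′
onlyIf-cong false z≋z′ = ≋-refl

extend-onlyIf-⟦⟧ : ∀ b (y : Chain n) → extend (λ m → onlyIf b ⟦ m ⟧) y ≋ onlyIf b y
extend-onlyIf-⟦⟧ true  y = extend-⟦⟧ y
extend-onlyIf-⟦⟧ false y = ≡⇒≋ (extend-const-[] y)

-- minus the wedge a ∧ y, as in the second term of d (a ∷ l) = l − a ∧ d l
_∧⁻_ : Root n → Chain n → Chain n
a ∧⁻ y = List.map (λ p → (- proj₁ p , a ∷ proj₂ p)) y

infixr 6 _∧⁻_

pairing-∧⁻ : ∀ (g : Mono n → ℤ) a y → pairing g (a ∧⁻ y) ≡ - pairing (λ m → g (a ∷ m)) y
pairing-∧⁻ g a [] = refl
pairing-∧⁻ g a ((k , m) ∷ y) =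
  trans (cong (_+_ ((- k) * g (a ∷ m))) (pairing-∧⁻ g a y)) (negate k (g (a ∷ m)) _)
  where
  negate : ∀ k a b → (- k) * a + - b ≡ - (k * a + b)
  negate = solve-∀

∧⁻-++ : ∀ (a : Root n) x y → a ∧⁻ (x ++ y) ≡ a ∧⁻ x ++ a ∧⁻ y
∧⁻-++ a x y = ListP.map-++ _ x y

∧⁻-cong : ∀ (a : Root n) {y y′} → y ≋ y′ → a ∧⁻ y ≋ a ∧⁻ y′
∧⁻-cong a {y} {y′} y≋y′ = ≋-by-pairing λ g →
  trans (pairing-∧⁻ g a y) (trans (cong -_ (pairing-resp _ y≋y′)) (sym (pairing-∧⁻ g a y′)))

extend-∧⁻ : ∀ (f : Mono n → Chain n) a y → extend f (a ∧⁻ y) ≋ neg (extend (λ m → f (a ∷ m)) y)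
extend-∧⁻ f a y = ≋-by-pairing λ g → begin
  pairing g (extend f (a ∧⁻ y))                ≡⟨ pairing-extend g f (a ∧⁻ y) ⟩
  pairing (λ m → pairing g (f m)) (a ∧⁻ y)     ≡⟨ pairing-∧⁻ _ a y ⟩
  - pairing (λ m → pairing g (f (a ∷ m))) y    ≡⟨ cong -_ (pairing-extend g _ y) ⟨
  - pairing g (extend (λ m → f (a ∷ m)) y)     ≡⟨ pairing-neg g (extend (λ m → f (a ∷ m)) y) ⟨
  pairing g (neg (extend (λ m → f (a ∷ m)) y)) ∎
  where open ≡-Reasoning

extend-∧⁻-pointwise : ∀ (f : Mono n → Chain n) a x → extend (λ m → a ∧⁻ f m) x ≋ a ∧⁻ extend f x
extend-∧⁻-pointwise f a x = ≋-by-pairing λ g → begin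
  pairing g (extend (λ m → a ∧⁻ f m) x)              ≡⟨ pairing-extend g _ x ⟩
  pairing (λ m → pairing g (a ∧⁻ f m)) x             ≡⟨ pairing-cong x (λ m → pairing-∧⁻ g a (f m)) ⟩
  pairing (λ m → - pairing (λ m′ → g (a ∷ m′)) (f m)) x  ≡⟨ pairing-- _ x ⟩
  - pairing (λ m → pairing (λ m′ → g (a ∷ m′)) (f m)) x  ≡⟨ cong -_ (pairing-extend _ f x) ⟨
  - pairing (λ m → g (a ∷ m)) (extend f x)           ≡⟨ pairing-∧⁻ g a (extend f x) ⟨
  pairing g (a ∧⁻ extend f x)                        ∎
  where open ≡-Reasoning

extend-prepend : ∀ (a : Root n) y → extend (λ μ → ⟦ a ∷ μ ⟧) y ≋ neg (a ∧⁻ y)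
extend-prepend a y = ≋-by-pairing λ g → begin
  pairing g (extend (λ μ → ⟦ a ∷ μ ⟧) y)   ≡⟨ pairing-extend g (λ μ → ⟦ a ∷ μ ⟧) y ⟩
  pairing (λ μ → 1ℤ * g (a ∷ μ) + 0ℤ) y
    ≡⟨ pairing-cong y (λ μ → trans (ℤP.+-identityʳ (1ℤ * g (a ∷ μ))) (ℤP.*-identityˡ (g (a ∷ μ)))) ⟩
  pairing (λ μ → g (a ∷ μ)) y              ≡⟨ ℤP.neg-involutive _ ⟨
  - - pairing (λ μ → g (a ∷ μ)) y          ≡⟨ cong -_ (pairing-∧⁻ g a y) ⟨
  - pairing g (a ∧⁻ y)                     ≡⟨ pairing-neg g (a ∧⁻ y) ⟨
  pairing g (neg (a ∧⁻ y))                 ∎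
  where open ≡-Reasoning

-- Partial boundaries

∂ : (Root n → Bool) → Mono n → Chain n
∂ P []      = []
∂ P (a ∷ l) = onlyIf (P a) ⟦ l ⟧ ++ a ∧⁻ ∂ P l

∂[_] : (Root n → Bool) → Chain n → Chain n
∂[ P ] = extend (∂ P)

dMono≡∂ : ∀ (m : Mono n) → dMono m ≡ ∂ (λ _ → true) m
dMono≡∂ []      = refl
dMono≡∂ (a ∷ l) = cong (λ y → (1ℤ , l) ∷ a ∧⁻ y) (dMono≡∂ l)

∂-split : ∀ (P : Root n → Bool) m → ∂ (λ _ → true) m ≋ ∂ P m ++ ∂ (not ∘ P) m
∂-split P []      = ≋-refl
∂-split P (a ∷ l) = begin
  ⟦ l ⟧ ++ a ∧⁻ ∂ (λ _ → true) l               ≈⟨ ++-congˡ ⟦ l ⟧ (∧⁻-cong a (∂-split P l)) ⟩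
  ⟦ l ⟧ ++ a ∧⁻ (∂ P l ++ ∂ (not ∘ P) l)       ≡⟨ cong (⟦ l ⟧ ++_) (∧⁻-++ a (∂ P l) (∂ (not ∘ P) l)) ⟩
  ⟦ l ⟧ ++ (a ∧⁻ ∂ P l ++ a ∧⁻ ∂ (not ∘ P) l)  ≈⟨ distribute (P a) ⟩
  (onlyIf (P a) ⟦ l ⟧ ++ a ∧⁻ ∂ P l) ++ (onlyIf (not (P a)) ⟦ l ⟧ ++ a ∧⁻ ∂ (not ∘ P) l) ∎
  where
  open ≋-Reasoning
  u = a ∧⁻ ∂ P l
  v = a ∧⁻ ∂ (not ∘ P) l
  distribute : ∀ b → ⟦ l ⟧ ++ (u ++ v) ≋ (onlyIf b ⟦ l ⟧ ++ u) ++ (onlyIf (not b) ⟦ l ⟧ ++ v)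
  distribute true  = ≡⇒≋ (sym (ListP.++-assoc ⟦ l ⟧ u v))
  distribute false = begin
    ⟦ l ⟧ ++ (u ++ v)  ≡⟨ ListP.++-assoc ⟦ l ⟧ u v ⟨
    (⟦ l ⟧ ++ u) ++ v  ≈⟨ ++-cong (++-comm ⟦ l ⟧ u) ≋-refl ⟩
    (u ++ ⟦ l ⟧) ++ v  ≡⟨ ListP.++-assoc u ⟦ l ⟧ v ⟩
    u ++ (⟦ l ⟧ ++ v)  ∎

d-split : ∀ (P : Root n → Bool) x → d x ≋ ∂[ P ] x ++ ∂[ not ∘ P ] x
d-split P x = begin
  d x                                               ≈⟨ extend-cong x (λ m → ≋-trans (≡⇒≋ (dMono≡∂ m)) (∂-split P m)) ⟩
  extend (λ m → ∂ P m ++ ∂ (not ∘ P) m) x           ≈⟨ extend-+ (∂ P) (∂ (not ∘ P)) x ⟩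
  ∂[ P ] x ++ ∂[ not ∘ P ] x                        ∎
  where open ≋-Reasoning

negative : Root n → Bool
negative = not ∘ nonNeg

d₊ d₋ : Chain n → Chain n
d₊ = ∂[ nonNeg ]
d₋ = ∂[ negative ]

extend-∂-cons : ∀ (f : Mono n → Chain n) P a l →
                extend f (∂ P (a ∷ l)) ≋ onlyIf (P a) (f l) ++ neg (extend (λ μ → f (a ∷ μ)) (∂ P l))
extend-∂-cons f P a l = begin
  extend f (onlyIf (P a) ⟦ l ⟧ ++ a ∧⁻ ∂ P l)                ≡⟨ extend-++ f (onlyIf (P a) ⟦ l ⟧) (a ∧⁻ ∂ P l) ⟩
  extend f (onlyIf (P a) ⟦ l ⟧) ++ extend f (a ∧⁻ ∂ P l)
    ≈⟨ ++-cong (≋-trans (≡⇒≋ (extend-onlyIf f (P a) ⟦ l ⟧)) (onlyIf-cong (P a) (extend-single f l)))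
               (extend-∧⁻ f a (∂ P l)) ⟩
  onlyIf (P a) (f l) ++ neg (extend (λ μ → f (a ∷ μ)) (∂ P l))  ∎
  where open ≋-Reasoning

extend-∂-prefixed : ∀ (P : Root n → Bool) b y → extend (λ m → ∂ P (b ∷ m)) y ≋ onlyIf (P b) y ++ b ∧⁻ ∂[ P ] y
extend-∂-prefixed P b y = begin
  extend (λ m → onlyIf (P b) ⟦ m ⟧ ++ b ∧⁻ ∂ P m) y                  ≈⟨ extend-+ _ _ y ⟩
  extend (λ m → onlyIf (P b) ⟦ m ⟧) y ++ extend (λ m → b ∧⁻ ∂ P m) y
    ≈⟨ ++-cong (extend-onlyIf-⟦⟧ (P b) y) (extend-∧⁻-pointwise (∂ P) b y) ⟩
  onlyIf (P b) y ++ b ∧⁻ ∂[ P ] y                                    ∎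
  where open ≋-Reasoning

∂[]-∂-cons : ∀ (P Q : Root n → Bool) a l →
             ∂[ P ] (∂ Q (a ∷ l)) ≋ onlyIf (Q a) (∂ P l) ++ neg (onlyIf (P a) (∂ Q l) ++ a ∧⁻ ∂[ P ] (∂ Q l))
∂[]-∂-cons P Q a l =
  ≋-trans (extend-∂-cons (∂ P) Q a l) (++-cong ≋-refl (neg-cong (extend-∂-prefixed P a (∂ Q l))))

cross-cancel : ∀ (u v w w′ : Chain n) → (u ++ neg (v ++ w)) ++ (v ++ neg (u ++ w′)) ≋ neg (w ++ w′)
cross-cancel u v w w′ = ≋-by-pairing λ g → begin
  pairing g ((u ++ neg (v ++ w)) ++ (v ++ neg (u ++ w′)))
    ≡⟨ expand g ⟩
  (pairing g u - (pairing g v + pairing g w)) + (pairing g v - (pairing g u + pairing g w′))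
    ≡⟨ cancel (pairing g u) (pairing g v) (pairing g w) (pairing g w′) ⟩
  - (pairing g w + pairing g w′)
    ≡⟨ cong -_ (pairing-++ g w w′) ⟨
  - pairing g (w ++ w′)
    ≡⟨ pairing-neg g (w ++ w′) ⟨
  pairing g (neg (w ++ w′))  ∎
  where
  open ≡-Reasoning
  cancel : ∀ a b c e → (a - (b + c)) + (b - (a + e)) ≡ - (c + e)
  cancel = solve-∀
  expand : ∀ g → pairing g ((u ++ neg (v ++ w)) ++ (v ++ neg (u ++ w′))) ≡
                 (pairing g u - (pairing g v + pairing g w)) + (pairing g v - (pairing g u + pairing g w′))
  expand g
    rewrite pairing-++ g (u ++ neg (v ++ w)) (v ++ neg (u ++ w′))
          | pairing-++ g u (neg (v ++ w)) | pairing-++ g v (neg (u ++ w′))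
          | pairing-neg g (v ++ w) | pairing-neg g (u ++ w′)
          | pairing-++ g v w | pairing-++ g u w′ = refl

∂∂-anticommute : ∀ (P Q : Root n → Bool) m → ∂[ P ] (∂ Q m) ++ ∂[ Q ] (∂ P m) ≋ []
∂∂-anticommute P Q []      = ≋-refl
∂∂-anticommute P Q (a ∷ l) = begin
  ∂[ P ] (∂ Q (a ∷ l)) ++ ∂[ Q ] (∂ P (a ∷ l))
    ≈⟨ ++-cong (∂[]-∂-cons P Q a l) (∂[]-∂-cons Q P a l) ⟩
  (onlyIf (Q a) (∂ P l) ++ neg (onlyIf (P a) (∂ Q l) ++ a ∧⁻ ∂[ P ] (∂ Q l))) ++
  (onlyIf (P a) (∂ Q l) ++ neg (onlyIf (Q a) (∂ P l) ++ a ∧⁻ ∂[ Q ] (∂ P l)))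
    ≈⟨ cross-cancel (onlyIf (Q a) (∂ P l)) (onlyIf (P a) (∂ Q l)) (a ∧⁻ ∂[ P ] (∂ Q l)) (a ∧⁻ ∂[ Q ] (∂ P l)) ⟩
  neg (a ∧⁻ ∂[ P ] (∂ Q l) ++ a ∧⁻ ∂[ Q ] (∂ P l))
    ≡⟨ cong neg (∧⁻-++ a (∂[ P ] (∂ Q l)) (∂[ Q ] (∂ P l))) ⟨
  neg (a ∧⁻ (∂[ P ] (∂ Q l) ++ ∂[ Q ] (∂ P l)))
    ≈⟨ neg-cong (∧⁻-cong a (∂∂-anticommute P Q l)) ⟩
  []  ∎
  where open ≋-Reasoning

∂[]∂[]-anticommute : ∀ (P Q : Root n → Bool) x → ∂[ P ] (∂[ Q ] x) ++ ∂[ Q ] (∂[ P ] x) ≋ []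
∂[]∂[]-anticommute P Q x = begin
  ∂[ P ] (∂[ Q ] x) ++ ∂[ Q ] (∂[ P ] x)
    ≈⟨ ++-cong (extend-∘ (∂ P) (∂ Q) x) (extend-∘ (∂ Q) (∂ P) x) ⟩
  extend (λ m → ∂[ P ] (∂ Q m)) x ++ extend (λ m → ∂[ Q ] (∂ P m)) x
    ≈⟨ extend-+ _ _ x ⟨
  extend (λ m → ∂[ P ] (∂ Q m) ++ ∂[ Q ] (∂ P m)) x
    ≈⟨ extend-cong x (∂∂-anticommute P Q) ⟩
  extend (λ _ → []) x
    ≡⟨ extend-const-[] x ⟩
  []  ∎
  where open ≋-Reasoning

∂[]∂[]≋-neg : ∀ (P Q : Root n → Bool) x → ∂[ P ] (∂[ Q ] x) ≋ neg (∂[ Q ] (∂[ P ] x))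
∂[]∂[]≋-neg P Q x = ≋-neg-of-sum (∂[]∂[]-anticommute P Q x)

∂[]²≋[] : ∀ (P : Root n → Bool) x → ∂[ P ] (∂[ P ] x) ≋ []
∂[]²≋[] P x = ≋-[]-of-double (∂[]∂[]-anticommute P P x)

lexLT-compare : Trichotomous (_≡_ {A = Root n}) lexLT
lexLT-compare Vec.[] Vec.[] = tri≈ (λ ()) refl (λ ())
lexLT-compare (x Vec.∷ u) (y Vec.∷ v) with ℤP.<-cmp x y
... | tri< x<y x≢y _ = tri< (inj₁ x<y) (x≢y ∘ VecP.∷-injectiveˡ)
  (λ { (inj₁ y<x) → ℤP.<-asym x<y y<x ; (inj₂ (y≡x , _)) → x≢y (sym y≡x) })
... | tri> _ x≢y y<x = tri> (λ { (inj₁ x<y) → ℤP.<-asym x<y y<x ; (inj₂ (x≡y , _)) → x≢y x≡y })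
  (x≢y ∘ VecP.∷-injectiveˡ) (inj₁ y<x)
... | tri≈ _ refl _ with lexLT-compare u v
...   | tri< u<v u≢v v≮u = tri< (inj₂ (refl , u<v)) (u≢v ∘ VecP.∷-injectiveʳ)
  (λ { (inj₁ x<x) → ℤP.<-irrefl refl x<x ; (inj₂ (_ , v<u)) → v≮u v<u })
...   | tri≈ u≮v refl v≮u = tri≈ (λ { (inj₁ x<x) → ℤP.<-irrefl refl x<x ; (inj₂ (_ , u<v)) → u≮v u<v }) refl
  (λ { (inj₁ x<x) → ℤP.<-irrefl refl x<x ; (inj₂ (_ , v<u)) → v≮u v<u })
...   | tri> u≮v u≢v v<u = tri> (λ { (inj₁ x<x) → ℤP.<-irrefl refl x<x ; (inj₂ (_ , u<v)) → u≮v u<v })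
  (u≢v ∘ VecP.∷-injectiveʳ) (inj₂ (refl , v<u))

lexLT-trans : {u v w : Root n} → lexLT u v → lexLT v w → lexLT u w
lexLT-trans {u = Vec.[]} {Vec.[]} {Vec.[]} ()
lexLT-trans {u = x Vec.∷ u} {y Vec.∷ v} {z Vec.∷ w} (inj₁ x<y) (inj₁ y<z) = inj₁ (ℤP.<-trans x<y y<z)
lexLT-trans {u = x Vec.∷ u} {y Vec.∷ v} {z Vec.∷ w} (inj₁ x<y) (inj₂ (refl , _)) = inj₁ x<y
lexLT-trans {u = x Vec.∷ u} {y Vec.∷ v} {z Vec.∷ w} (inj₂ (refl , _)) (inj₁ y<z) = inj₁ y<z
lexLT-trans {u = x Vec.∷ u} {y Vec.∷ v} {z Vec.∷ w} (inj₂ (refl , u<v)) (inj₂ (refl , v<w)) =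
  inj₂ (refl , lexLT-trans u<v v<w)

Sorted : Mono n → Set
Sorted = Linked lexLT

Sorted⇒All-head : ∀ {b : Root n} {τ} → Sorted (b ∷ τ) → All (lexLT b) τ
Sorted⇒All-head {τ = []} _ = []
Sorted⇒All-head {τ = c ∷ τ} (b<c ∷ sorted) = b<c ∷ All.map (lexLT-trans b<c) (Sorted⇒All-head sorted)

Sorted-tail : ∀ {b : Root n} {τ} → Sorted (b ∷ τ) → Sorted τ
Sorted-tail [-]          = []
Sorted-tail (_ ∷ sorted) = sorted

Sorted-cons : ∀ {b : Root n} {τ} → All (lexLT b) τ → Sorted τ → Sorted (b ∷ τ)
Sorted-cons {τ = []}    _         _      = [-]
Sorted-cons {τ = _ ∷ _} (b<c ∷ _) sorted = b<c ∷ sorted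

data Removal (P : Root n → Bool) : Mono n → Mono n → Set where
  here  : ∀ {b τ} → P b ≡ true → Removal P (b ∷ τ) τ
  there : ∀ {b σ τ} → Removal P σ τ → Removal P (b ∷ σ) (b ∷ τ)

∂-removals : ∀ (P : Root n → Bool) σ → All (λ q → Removal P σ (proj₂ q)) (∂ P σ)
∂-removals P []      = []
∂-removals P (a ∷ l) = AllP.++⁺ (head (P a) refl) (AllP.map⁺ (All.map there (∂-removals P l)))
  where
  head : ∀ b → P a ≡ b → All (λ q → Removal P (a ∷ l) (proj₂ q)) (onlyIf b ⟦ l ⟧)
  head true  Pa = here Pa ∷ []
  head false _  = []

removal-of-Any : ∀ {P : Root n → Bool} {σ} → Any (λ b → P b ≡ true) σ → Σ (Mono n) (Removal P σ)
removal-of-Any (here Pb)  = _ , here Pb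
removal-of-Any (there pσ) = let τ , r = removal-of-Any pσ in _ , there r

Removal⇒Any : ∀ {P : Root n → Bool} {σ τ} → Removal P σ τ → Any (λ b → P b ≡ true) σ
Removal⇒Any (here Pb) = here Pb
Removal⇒Any (there r) = there (Removal⇒Any r)

removed : ∀ {P : Root n → Bool} {σ τ} → Removal P σ τ → Root n
removed (here {b} _) = b
removed (there r)    = removed r

removed-satisfies : ∀ {P : Root n → Bool} {σ τ} (r : Removal P σ τ) → P (removed r) ≡ true
removed-satisfies (here Pb) = Pb
removed-satisfies (there r) = removed-satisfies r

module _ {P : Root n → Bool} {Q : Root n → Set} where

  removed-All : ∀ {σ τ} (r : Removal P σ τ) → All Q σ → Q (removed r)
  removed-All (here _)  (q ∷ _)  = q
  removed-All (there r) (_ ∷ qs) = removed-All r qs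

  Removal-All : ∀ {σ τ} → Removal P σ τ → All Q σ → All Q τ
  Removal-All (here _)  (_ ∷ qs) = qs
  Removal-All (there r) (q ∷ qs) = q ∷ Removal-All r qs

  Removal-Any : ∀ {σ τ} → Removal P σ τ → (∀ {b} → P b ≡ true → ¬ Q b) → Any Q σ → Any Q τ
  Removal-Any (here Pb) P⇒¬Q (here q)  = ⊥-elim (P⇒¬Q Pb q)
  Removal-Any (here _)  _    (there a) = a
  Removal-Any (there r) _    (here q)  = here q
  Removal-Any (there r) P⇒¬Q (there a) = there (Removal-Any r P⇒¬Q a)

module _ {P : Root n → Bool} {R : Root n → Root n → Set} where

  Removal-AllPairs : ∀ {σ τ} → Removal P σ τ → AllPairs R σ → AllPairs R τ
  Removal-AllPairs (here _)  (_ ∷ rs)  = rs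
  Removal-AllPairs (there r) (rb ∷ rs) = Removal-All r rb ∷ Removal-AllPairs r rs

  removed-related : Symmetric R → ∀ {σ τ} (r : Removal P σ τ) → AllPairs R σ → All (R (removed r)) τ
  removed-related sym (here _)  (rb ∷ _)  = rb
  removed-related sym (there r) (rb ∷ rs) = sym (removed-All r rb) ∷ removed-related sym r rs

AllPairs-resp-↭ : ∀ {R : Root n → Root n → Set} → Symmetric R →
                  ∀ {σ τ} → σ ↭ τ → AllPairs R σ → AllPairs R τ
AllPairs-resp-↭ {R = R} sym σ↭τ = PermutationSetoid.AllPairs-resp-↭ (≡.setoid _) sym (≡.resp₂ R) (↭⇒↭ₛ σ↭τ)

Removal-Sorted : ∀ {P : Root n → Bool} {σ τ} → Removal P σ τ → Sorted σ → Sorted τ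
Removal-Sorted r = AllPairs⇒Linked ∘ Removal-AllPairs r ∘ Linked⇒AllPairs lexLT-trans

-- Wedging with a root

-- a ∧ σ for sorted σ, as ± the sorted monomial (0 if a occurs in σ)
wedge : Root n → Mono n → Chain n
wedge a []      = ⟦ a ∷ [] ⟧
wedge a (b ∷ σ) with lexLT-compare a b
... | tri< _ _ _ = ⟦ a ∷ b ∷ σ ⟧
... | tri≈ _ _ _ = []
... | tri> _ _ _ = b ∧⁻ wedge a σ

wedge-below : ∀ (a : Root n) σ → All (lexLT a) σ → wedge a σ ≡ ⟦ a ∷ σ ⟧
wedge-below a []      _           = refl
wedge-below a (b ∷ σ) (a<b ∷ _) with lexLT-compare a b
... | tri< _ _ _    = refl
... | tri≈ a≮b _ _  = ⊥-elim (a≮b a<b)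
... | tri> a≮b _ _  = ⊥-elim (a≮b a<b)

wedge-self : ∀ (a : Root n) σ → wedge a (a ∷ σ) ≡ []
wedge-self a σ with lexLT-compare a a
... | tri< _ a≢a _ = ⊥-elim (a≢a refl)
... | tri≈ _ _ _   = refl
... | tri> _ a≢a _ = ⊥-elim (a≢a refl)

wedge-above : ∀ (a b : Root n) σ → lexLT b a → wedge a (b ∷ σ) ≡ b ∧⁻ wedge a σ
wedge-above a b σ b<a with lexLT-compare a b
... | tri< _ _ b≮a = ⊥-elim (b≮a b<a)
... | tri≈ _ _ b≮a = ⊥-elim (b≮a b<a)
... | tri> _ _ _   = refl

wedge-sorted : ∀ (a : Root n) σ → Sorted σ → All (λ q → Sorted (proj₂ q) × proj₂ q ↭ a ∷ σ) (wedge a σ)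
wedge-sorted a []      _      = ([-] , ↭-refl) ∷ []
wedge-sorted a (b ∷ σ) sorted with lexLT-compare a b
... | tri< a<b _ _ = (a<b ∷ sorted , ↭-refl) ∷ []
... | tri≈ _ _ _   = []
... | tri> _ _ b<a = AllP.map⁺ (All.map cons-b (wedge-sorted a σ (Sorted-tail sorted)))
  where
  cons-b : ∀ {μ} → Sorted μ × μ ↭ a ∷ σ → Sorted (b ∷ μ) × b ∷ μ ↭ a ∷ b ∷ σ
  cons-b (sorted-μ , μ↭) =
    Sorted-cons (All-resp-↭ (↭-sym μ↭) (b<a ∷ Sorted⇒All-head sorted)) sorted-μ ,
    ↭-trans (↭-prep b μ↭) (↭-swap b a ↭-refl)

∂-wedge-below : ∀ (P : Root n → Bool) a σ → All (lexLT a) σ →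
                ∂[ P ] ⟦ a ∷ σ ⟧ ++ extend (wedge a) (∂ P σ) ≋ onlyIf (P a) ⟦ σ ⟧
∂-wedge-below P a σ a<σ = begin
  ∂[ P ] ⟦ a ∷ σ ⟧ ++ extend (wedge a) (∂ P σ)
    ≈⟨ ++-cong (extend-single (∂ P) (a ∷ σ)) (extend-cong-on (∂ P σ) (All.map wedge-on-face (∂-removals P σ))) ⟩
  (onlyIf (P a) ⟦ σ ⟧ ++ a ∧⁻ ∂ P σ) ++ extend (λ μ → ⟦ a ∷ μ ⟧) (∂ P σ)
    ≈⟨ ++-congˡ (onlyIf (P a) ⟦ σ ⟧ ++ a ∧⁻ ∂ P σ) (extend-prepend a (∂ P σ)) ⟩
  (onlyIf (P a) ⟦ σ ⟧ ++ a ∧⁻ ∂ P σ) ++ neg (a ∧⁻ ∂ P σ)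
    ≡⟨ ListP.++-assoc (onlyIf (P a) ⟦ σ ⟧) (a ∧⁻ ∂ P σ) (neg (a ∧⁻ ∂ P σ)) ⟩
  onlyIf (P a) ⟦ σ ⟧ ++ (a ∧⁻ ∂ P σ ++ neg (a ∧⁻ ∂ P σ))
    ≈⟨ ++-congˡ (onlyIf (P a) ⟦ σ ⟧) (++-inverseʳ (a ∧⁻ ∂ P σ)) ⟩
  onlyIf (P a) ⟦ σ ⟧ ++ []
    ≈⟨ ++-identityʳ (onlyIf (P a) ⟦ σ ⟧) ⟩
  onlyIf (P a) ⟦ σ ⟧  ∎
  where
  open ≋-Reasoning
  wedge-on-face : ∀ {μ} → Removal P σ μ → wedge a μ ≋ ⟦ a ∷ μ ⟧
  wedge-on-face r = ≡⇒≋ (wedge-below a _ (Removal-All r a<σ))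

∂-wedge-self : ∀ (P : Root n → Bool) a τ → All (lexLT a) τ →
               extend (wedge a) (∂ P (a ∷ τ)) ≋ onlyIf (P a) ⟦ a ∷ τ ⟧
∂-wedge-self P a τ a<τ = begin
  extend (wedge a) (∂ P (a ∷ τ))
    ≈⟨ extend-∂-cons (wedge a) P a τ ⟩
  onlyIf (P a) (wedge a τ) ++ neg (extend (λ μ → wedge a (a ∷ μ)) (∂ P τ))
    ≈⟨ ++-cong (≡⇒≋ (cong (onlyIf (P a)) (wedge-below a τ a<τ)))
               (neg-cong (≋-trans (extend-cong (∂ P τ) (λ μ → ≡⇒≋ (wedge-self a μ)))
                                  (≡⇒≋ (extend-const-[] (∂ P τ))))) ⟩
  onlyIf (P a) ⟦ a ∷ τ ⟧ ++ []
    ≈⟨ ++-identityʳ _ ⟩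
  onlyIf (P a) ⟦ a ∷ τ ⟧  ∎
  where open ≋-Reasoning

∂-wedge-above : ∀ (P : Root n → Bool) a b τ → lexLT b a →
                ∂[ P ] (wedge a τ) ++ extend (wedge a) (∂ P τ) ≋ onlyIf (P a) ⟦ τ ⟧ →
                ∂[ P ] (b ∧⁻ wedge a τ) ++ extend (wedge a) (∂ P (b ∷ τ)) ≋ onlyIf (P a) ⟦ b ∷ τ ⟧
∂-wedge-above P a b τ b<a ∂-wedge-τ = begin
  ∂[ P ] (b ∧⁻ wedge a τ) ++ extend (wedge a) (∂ P (b ∷ τ))
    ≈⟨ ++-cong (≋-trans (extend-∧⁻ (∂ P) b (wedge a τ)) (neg-cong (extend-∂-prefixed P b (wedge a τ)))) wedge-faces ⟩
  neg (onlyIf (P b) (wedge a τ) ++ b ∧⁻ ∂[ P ] (wedge a τ)) ++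
    (onlyIf (P b) (wedge a τ) ++ neg (b ∧⁻ extend (wedge a) (∂ P τ)))
    ≈⟨ cross-cancel [] (onlyIf (P b) (wedge a τ)) (b ∧⁻ ∂[ P ] (wedge a τ)) (b ∧⁻ extend (wedge a) (∂ P τ)) ⟩
  neg (b ∧⁻ ∂[ P ] (wedge a τ) ++ b ∧⁻ extend (wedge a) (∂ P τ))
    ≡⟨ cong neg (∧⁻-++ b (∂[ P ] (wedge a τ)) (extend (wedge a) (∂ P τ))) ⟨
  neg (b ∧⁻ (∂[ P ] (wedge a τ) ++ extend (wedge a) (∂ P τ)))
    ≈⟨ neg-cong (∧⁻-cong b ∂-wedge-τ) ⟩
  neg (b ∧⁻ onlyIf (P a) ⟦ τ ⟧)
    ≡⟨ neg-∧⁻-onlyIf (P a) ⟩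
  onlyIf (P a) ⟦ b ∷ τ ⟧  ∎
  where
  open ≋-Reasoning
  wedge-faces : extend (wedge a) (∂ P (b ∷ τ)) ≋ onlyIf (P b) (wedge a τ) ++ neg (b ∧⁻ extend (wedge a) (∂ P τ))
  wedge-faces = ≋-trans (extend-∂-cons (wedge a) P b τ)
    (++-congˡ (onlyIf (P b) (wedge a τ)) (neg-cong (≋-trans (extend-cong (∂ P τ) (λ μ → ≡⇒≋ (wedge-above a b μ b<a)))
                                                            (extend-∧⁻-pointwise (wedge a) b (∂ P τ)))))
  neg-∧⁻-onlyIf : ∀ c → neg (b ∧⁻ onlyIf c ⟦ τ ⟧) ≡ onlyIf c ⟦ b ∷ τ ⟧
  neg-∧⁻-onlyIf true  = refl
  neg-∧⁻-onlyIf false = refl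

∂-wedge : ∀ (P : Root n → Bool) a σ → Sorted σ →
          ∂[ P ] (wedge a σ) ++ extend (wedge a) (∂ P σ) ≋ onlyIf (P a) ⟦ σ ⟧
∂-wedge P a []      _      = ∂-wedge-below P a [] []
∂-wedge P a (b ∷ τ) sorted with lexLT-compare a b
... | tri< a<b _ _  = ∂-wedge-below P a (b ∷ τ) (a<b ∷ All.map (lexLT-trans a<b) (Sorted⇒All-head sorted))
... | tri≈ _ refl _ = ∂-wedge-self P a τ (Sorted⇒All-head sorted)
... | tri> _ _ b<a  = ∂-wedge-above P a b τ b<a (∂-wedge P a τ (Sorted-tail sorted))

positives : Mono n → Mono n
positives = List.filter (λ v → T? (nonNeg v))

positives-removal-negative : ∀ {σ τ : Mono n} → Removal negative σ τ → positives σ ≡ positives τ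
positives-removal-negative {σ = b ∷ σ} (here nb) with nonNeg b
positives-removal-negative (here ()) | true
... | false = refl
positives-removal-negative {σ = b ∷ σ} (there r) with nonNeg b
... | true  = cong (b ∷_) (positives-removal-negative r)
... | false = positives-removal-negative r

posCount-removal-nonNeg : ∀ {σ τ : Mono n} → Removal nonNeg σ τ → posCount σ ≡ suc (posCount τ)
posCount-removal-nonNeg {σ = b ∷ τ} (here pb) with nonNeg b
... | true = refl
posCount-removal-nonNeg {σ = b ∷ σ} (there r) with nonNeg b
... | true  = cong suc (posCount-removal-nonNeg r)
... | false = posCount-removal-nonNeg r

posCount-↭ : ∀ {σ τ : Mono n} → σ ↭ τ → posCount σ ≡ posCount τ
posCount-↭ σ↭τ = ↭-length (filter-↭ (λ v → T? (nonNeg v)) σ↭τ)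

nonNeg-negSimple : ∀ (k : Fin n) → nonNeg (negSimple k) ≡ false
nonNeg-negSimple {suc n} zero    = refl
nonNeg-negSimple {suc n} (suc k) = nonNeg-negSimple k

negative-negSimple : ∀ (k : Fin n) → negative (negSimple k) ≡ true
negative-negSimple k = cong not (nonNeg-negSimple k)

nonNeg-positive : ∀ {v : Root n} → VAll.All (0ℤ ℤ.≤_) v → nonNeg v ≡ true
nonNeg-positive VAll.[] = refl
nonNeg-positive {v = x Vec.∷ v} (0≤x VAll.∷ 0≤v) rewrite Dec.dec-true (0ℤ ℤ.≤? x) 0≤x = nonNeg-positive 0≤v

clamp-negSimple : ∀ (j k : Fin n) → clamp (Vec.lookup (negSimple j) k) ≡ 0
clamp-negSimple {suc n} zero    zero    = refl
clamp-negSimple {suc n} zero    (suc k) = cong clamp (VecP.lookup-replicate k 0ℤ)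
clamp-negSimple {suc n} (suc j) zero    = refl
clamp-negSimple {suc n} (suc j) (suc k) = clamp-negSimple j k

∂-nonNeg-posCount-0 : ∀ (m : Mono n) → posCount m ≡ 0 → ∂ nonNeg m ≡ []
∂-nonNeg-posCount-0 []      _  = refl
∂-nonNeg-posCount-0 (a ∷ l) pc with nonNeg a
∂-nonNeg-posCount-0 (a ∷ l) () | true
... | false = cong (a ∧⁻_) (∂-nonNeg-posCount-0 l pc)

posCount-in-top-layer : ∀ p a → + (clamp p ℕ.+ a) ≡ p → a ≡ 0
posCount-in-top-layer (+ k) a e = ℕP.+-cancelˡ-≡ k a 0 (trans (ℤP.+-injective e) (sym (ℕP.+-identityʳ k)))

-- Restrictions, columns and the filtration

restrict : {S : Mono n → Set} → (∀ m → Dec (S m)) → Chain n → Chain n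
restrict S? = extend (λ m → onlyIf (does (S? m)) ⟦ m ⟧)

restrict-All : ∀ {S : Mono n → Set} (S? : ∀ m → Dec (S m)) x → All (S ∘ proj₂) (restrict S? x)
restrict-All {S = S} S? x = All-extend _ x (All.universal (λ p → only (S? (proj₂ p))) x)
  where
  only : ∀ {m} (s? : Dec (S m)) → All (S ∘ proj₂) (onlyIf (does s?) ⟦ m ⟧)
  only (yes s) = s ∷ []
  only (no _)  = []

restrict-keeps : ∀ {S Q : Mono n → Set} (S? : ∀ m → Dec (S m)) {x} →
                 All (Q ∘ proj₂) x → All (Q ∘ proj₂) (restrict S? x)
restrict-keeps {Q = Q} S? {x} qs = All-extend _ x (All.map (λ {p} q → keep (does (S? (proj₂ p))) q) qs)
  where
  keep : ∀ b {m} → Q m → All (Q ∘ proj₂) (onlyIf b ⟦ m ⟧)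
  keep true  q = q ∷ []
  keep false _ = []

coeff-restrict : ∀ {S : Mono n → Set} (S? : ∀ m → Dec (S m)) x l →
                 coeff (restrict S? x) l ≡ (if does (S? l) then coeff x l else 0ℤ)
coeff-restrict S? x l = begin
  coeff (restrict S? x) l                                        ≡⟨ coeff≡pairing-indicator (restrict S? x) l ⟩
  pairing (indicator l) (restrict S? x)                          ≡⟨ pairing-extend (indicator l) _ x ⟩
  pairing (λ m → pairing (indicator l) (onlyIf (does (S? m)) ⟦ m ⟧)) x
    ≡⟨ pairing-cong x (λ m → trans (pairing-onlyIf (does (S? m)) m) (at-l m)) ⟩
  pairing (λ m → if does (S? l) then indicator l m else 0ℤ) x    ≡⟨ pull-out (does (S? l)) ⟩
  (if does (S? l) then coeff x l else 0ℤ)                        ∎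
  where
  open ≡-Reasoning
  pairing-onlyIf : ∀ b m → pairing (indicator l) (onlyIf b ⟦ m ⟧) ≡ (if b then indicator l m else 0ℤ)
  pairing-onlyIf true  m = trans (ℤP.+-identityʳ _) (ℤP.*-identityˡ _)
  pairing-onlyIf false m = refl
  at-l : ∀ m → (if does (S? m) then indicator l m else 0ℤ) ≡ (if does (S? l) then indicator l m else 0ℤ)
  at-l m with m ≟M l
  ... | yes refl = refl
  ... | no _     = trans (vanish (does (S? m))) (sym (vanish (does (S? l))))
    where
    vanish : ∀ b → (if b then 0ℤ else 0ℤ) ≡ 0ℤ
    vanish true  = refl
    vanish false = refl
  pull-out : ∀ b → pairing (λ m → if b then indicator l m else 0ℤ) x ≡ (if b then coeff x l else 0ℤ)
  pull-out true  = sym (coeff≡pairing-indicator x l)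
  pull-out false = pairing-0 x

restrict-∂ : ∀ (P : Root n → Bool) {S S′ : Mono n → Set} (S? : ∀ m → Dec (S m)) (S′? : ∀ m → Dec (S′ m)) →
             (∀ {σ τ} → Removal P σ τ → does (S? τ) ≡ does (S′? σ)) →
             ∀ x → restrict S? (∂[ P ] x) ≋ ∂[ P ] (restrict S′? x)
restrict-∂ P S? S′? shift x = begin
  restrict S? (∂[ P ] x)                                  ≈⟨ extend-∘ _ (∂ P) x ⟩
  extend (λ σ → restrict S? (∂ P σ)) x                    ≈⟨ extend-cong x on-faces ⟩
  extend (λ σ → onlyIf (does (S′? σ)) (∂ P σ)) x          ≈⟨ extend-cong x on-restriction ⟨
  extend (λ σ → ∂[ P ] (onlyIf (does (S′? σ)) ⟦ σ ⟧)) x   ≈⟨ extend-∘ (∂ P) _ x ⟨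
  ∂[ P ] (restrict S′? x)                                 ∎
  where
  open ≋-Reasoning
  on-faces : ∀ σ → restrict S? (∂ P σ) ≋ onlyIf (does (S′? σ)) (∂ P σ)
  on-faces σ = ≋-trans (extend-cong-on (∂ P σ) (All.map (λ r → ≡⇒≋ (cong (λ b → onlyIf b ⟦ _ ⟧) (shift r)))
                                                         (∂-removals P σ)))
                       (extend-onlyIf-⟦⟧ (does (S′? σ)) (∂ P σ))
  on-restriction : ∀ σ → ∂[ P ] (onlyIf (does (S′? σ)) ⟦ σ ⟧) ≋ onlyIf (does (S′? σ)) (∂ P σ)
  on-restriction σ = ≋-trans (≡⇒≋ (extend-onlyIf (∂ P) (does (S′? σ)) ⟦ σ ⟧))
                             (onlyIf-cong (does (S′? σ)) (extend-single (∂ P) σ))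

inColumn? : ∀ q (m : Mono n) → Dec (+ posCount m ≡ q)
inColumn? q m = + posCount m ℤ.≟ q

atMost? : ∀ q (m : Mono n) → Dec (+ posCount m ℤ.≤ q)
atMost? q m = + posCount m ℤ.≤? q

column : ℤ → Chain n → Chain n
column q = restrict (inColumn? q)

below : ℤ → Chain n → Chain n
below q = restrict (atMost? q)

does-≟-suc : ∀ a q → does (+ a ℤ.≟ q) ≡ does (+ suc a ℤ.≟ q + 1ℤ)
does-≟-suc a q with + a ℤ.≟ q
... | yes refl = sym (Dec.dec-true (+ suc a ℤ.≟ + a + 1ℤ) (cong +_ (ℕP.+-comm 1 a)))
... | no a≢q   = sym (Dec.dec-false (+ suc a ℤ.≟ q + 1ℤ) (λ e → a≢q (trans (cong (_- 1ℤ) e) (cancel q))))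
  where
  cancel : ∀ q → q + 1ℤ - 1ℤ ≡ q
  cancel = solve-∀

column-d : ∀ q (x : Chain n) → column q (d x) ≋ d₊ (column (q + 1ℤ) x) ++ d₋ (column q x)
column-d q x = begin
  column q (d x)                                              ≈⟨ extend-resp _ (d-split nonNeg x) ⟩
  column q (d₊ x ++ d₋ x)                                     ≡⟨ extend-++ _ (d₊ x) (d₋ x) ⟩
  column q (d₊ x) ++ column q (d₋ x)
    ≈⟨ ++-cong (restrict-∂ nonNeg (inColumn? q) (inColumn? (q + 1ℤ)) one-fewer x)
               (restrict-∂ negative (inColumn? q) (inColumn? q) as-many x) ⟩
  d₊ (column (q + 1ℤ) x) ++ d₋ (column q x)                   ∎
  where
  open ≋-Reasoning
  one-fewer : ∀ {σ τ} → Removal nonNeg σ τ → does (inColumn? q τ) ≡ does (inColumn? (q + 1ℤ) σ)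
  one-fewer r = trans (does-≟-suc _ q) (cong (λ a → does (+ a ℤ.≟ q + 1ℤ)) (sym (posCount-removal-nonNeg r)))
  as-many : ∀ {σ τ} → Removal negative σ τ → does (inColumn? q τ) ≡ does (inColumn? q σ)
  as-many r = cong (λ a → does (+ a ℤ.≟ q)) (sym (cong length (positives-removal-negative r)))

InF-column : ∀ {s q} (y : Chain n) → InF s y → s ℤ.< q → column q y ≋ []
InF-column {s = s} {q} y y∈Fs s<q = mk≋ λ l → trans (coeff-restrict (inColumn? q) y l) (vanish l (+ posCount l ℤ.≟ q))
  where
  vanish : ∀ l (l∈q? : Dec (+ posCount l ≡ q)) → (if does l∈q? then coeff y l else 0ℤ) ≡ 0ℤ
  vanish l (no _)    = refl
  vanish l (yes refl) with coeff y l ℤ.≟ 0ℤ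
  ... | yes c≡0 = c≡0
  ... | no c≢0  = ⊥-elim (ℤP.<-irrefl refl (ℤP.≤-<-trans (y∈Fs l c≢0) s<q))

InF-split : ∀ p (x : Chain n) → InF p x → x ≋ below (p - 1ℤ) x ++ column p x
InF-split p x x∈Fp = mk≋ λ l → begin
  coeff x l                                          ≡⟨ split l (coeff x l ℤ.≟ 0ℤ) ⟩
  (if does (+ posCount l ℤ.≤? p - 1ℤ) then coeff x l else 0ℤ) +
  (if does (+ posCount l ℤ.≟ p) then coeff x l else 0ℤ)
    ≡⟨ cong₂ _+_ (coeff-restrict (atMost? (p - 1ℤ)) x l) (coeff-restrict (inColumn? p) x l) ⟨
  coeff (below (p - 1ℤ) x) l + coeff (column p x) l  ≡⟨ coeff-++ (below (p - 1ℤ) x) (column p x) l ⟨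
  coeff (below (p - 1ℤ) x ++ column p x) l           ∎
  where
  open ≡-Reasoning
  below-p : ∀ {a} → a ℤ.≤ p - 1ℤ → a ≢ p
  below-p {a} a≤p-1 refl = ℤP.<-irrefl refl (ℤP.i≤pred[j]⇒i<j (subst (a ℤ.≤_) (ℤP.+-comm p ℤ.-1ℤ) a≤p-1))
  above : ∀ {a} → ¬ a ℤ.≤ p - 1ℤ → a ℤ.≤ p → a ≡ p
  above {a} a≰p-1 a≤p = ℤP.≤-antisym a≤p (subst (ℤ._≤ a) (succ-pred p) (ℤP.i<j⇒suc[i]≤j (ℤP.≰⇒> a≰p-1)))
    where
    succ-pred : ∀ p → 1ℤ + (p - 1ℤ) ≡ p
    succ-pred = solve-∀
  split : ∀ l → Dec (coeff x l ≡ 0ℤ) →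
          coeff x l ≡ (if does (+ posCount l ℤ.≤? p - 1ℤ) then coeff x l else 0ℤ) +
                      (if does (+ posCount l ℤ.≟ p) then coeff x l else 0ℤ)
  split l (yes c≡0) rewrite c≡0 with does (+ posCount l ℤ.≤? p - 1ℤ) | does (+ posCount l ℤ.≟ p)
  ... | true  | true  = refl
  ... | true  | false = refl
  ... | false | true  = refl
  ... | false | false = refl
  split l (no c≢0) with + posCount l ℤ.≤? p - 1ℤ
  ... | yes a≤p-1 rewrite Dec.dec-false (+ posCount l ℤ.≟ p) (below-p a≤p-1) = sym (ℤP.+-identityʳ _)
  ... | no a≰p-1  rewrite Dec.dec-true (+ posCount l ℤ.≟ p) (above a≰p-1 (x∈Fp l c≢0)) = sym (ℤP.+-identityˡ _)

InF-of-All : ∀ {s} (y : Chain n) → All (λ e → + posCount (proj₂ e) ℤ.≤ s) y → InF s y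
InF-of-All {s = s} y bounded l c≢0 with + posCount l ℤ.≤? s
... | yes l≤s = l≤s
... | no l≰s  = ⊥-elim (c≢0 (coeff-absent y l (All.map (λ {e} e≤s e≡l → l≰s (subst (λ m → + posCount m ℤ.≤ s) e≡l e≤s))
                                                      bounded)))

InF-resp : ∀ {s} {x y : Chain n} → x ≋ y → InF s x → InF s y
InF-resp x≋y x∈F l c≢0 = x∈F l (λ c≡0 → c≢0 (trans (sym (coeff-≡ x≋y l)) c≡0))

InF-mono : ∀ {s s′} {x : Chain n} → s ℤ.≤ s′ → InF s x → InF s′ x
InF-mono s≤s′ x∈F l c≢0 = ℤP.≤-trans (x∈F l c≢0) s≤s′

InF-[] : ∀ {s} → InF {n} s []
InF-[] l 0≢0 = ⊥-elim (0≢0 refl)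

<-of-suc≡ : ∀ {i j} → 1ℤ + i ≡ j → i ℤ.< j
<-of-suc≡ = ℤP.suc[i]≤j⇒i<j ∘ ℤP.≤-reflexive

i-1<i : ∀ i → i - 1ℤ ℤ.< i
i-1<i i = <-of-suc≡ (step i)
  where
  step : ∀ i → 1ℤ + (i - 1ℤ) ≡ i
  step = solve-∀

i-2<i-1 : ∀ i → i - + 2 ℤ.< i - 1ℤ
i-2<i-1 i = <-of-suc≡ (step i)
  where
  step : ∀ i → 1ℤ + (i - + 2) ≡ i - 1ℤ
  step = solve-∀

d₋-top-column : ∀ p (x : Chain n) → InF p x → InF (p - + 2) (d x) → d₋ (column p x) ≋ []
d₋-top-column p x x∈Fp dx∈Fp-2 =
  ≋-[]-of-sum (extend-resp (∂ nonNeg) (InF-column x x∈Fp (<-of-suc≡ (ℤP.+-comm 1ℤ p))))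
              (≋-trans (≋-sym (column-d p x)) (InF-column (d x) dx∈Fp-2 (ℤP.<-trans (i-2<i-1 p) (i-1<i p))))

d₊-top-column : ∀ p (x : Chain n) → InF (p - + 2) (d x) → d₊ (column p x) ≋ neg (d₋ (column (p - 1ℤ) x))
d₊-top-column p x dx∈Fp-2 = ≋-neg-of-sum (begin
  d₊ (column p x) ++ d₋ (column (p - 1ℤ) x)
    ≡⟨ cong (λ q → d₊ (column q x) ++ d₋ (column (p - 1ℤ) x)) (back p) ⟨
  d₊ (column (p - 1ℤ + 1ℤ) x) ++ d₋ (column (p - 1ℤ) x) ≈⟨ column-d (p - 1ℤ) x ⟨
  column (p - 1ℤ) (d x)                                 ≈⟨ InF-column (d x) dx∈Fp-2 (i-2<i-1 p) ⟩
  []                                                    ∎)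
  where
  open ≋-Reasoning
  back : ∀ p → p - 1ℤ + 1ℤ ≡ p
  back = solve-∀

-- Cones and the contraction of d₋

module ConeComplex {n : ℕ} (A : CartanMatrix n) (c : Root n → Root n → ℕ)
                   (negSimple-compatible : ∀ i j → c (negSimple i) (negSimple j) ≡ 0) where

  Compatible : Root n → Root n → Set
  Compatible α β = c α β ≡ 0 × c β α ≡ 0

  compatible? : ∀ α β → Dec (Compatible α β)
  compatible? α β = c α β ℕ.≟ 0 ×-dec c β α ℕ.≟ 0

  Compatible-sym : Symmetric Compatible
  Compatible-sym (αβ , βα) = βα , αβ

  Cone : Mono n → Set
  Cone = IsCone A c

  Removal-Cone : ∀ {P σ τ} → Removal P σ τ → Cone σ → Cone τ
  Removal-Cone r (aps , sorted , compatible) =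
    Removal-All r aps , Removal-Sorted r sorted , Removal-AllPairs r compatible

  negative-almostPositive : ∀ {β} → IsAlmostPositive A β → negative β ≡ true → Σ (Fin n) (λ j → β ≡ negSimple j)
  negative-almostPositive (inj₁ (_ , 0≤β)) nβ with () ← trans (cong not (sym (nonNeg-positive 0≤β))) nβ
  negative-almostPositive (inj₂ β≡-αj) _ = β≡-αj

  -- for P the positive roots of a cone σ: σ extends to a cone σ ∪ {−α_k}
  Fitting : Mono n → Set
  Fitting P = Any (λ k → All (Compatible (negSimple k)) P) (allFin n)

  fitting? : ∀ P → Dec (Fitting P)
  fitting? P = any? (λ k → all? (compatible? (negSimple k)) P) (allFin n)

  contraction : ∀ {P} → Dec (Fitting P) → Mono n → Chain n
  contraction (yes fits) = wedge (negSimple (proj₁ (satisfied fits)))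
  contraction (no _)     = λ _ → []

  projection : ∀ {P} → Dec (Fitting P) → Mono n → Chain n
  projection (yes _) = λ _ → []
  projection (no _)  = ⟦_⟧

  -- h and π see σ only through its positive roots, which d₋ leaves unchanged
  h : Mono n → Chain n
  h σ = contraction (fitting? (positives σ)) σ

  π : Mono n → Chain n
  π σ = projection (fitting? (positives σ)) σ

  HasNegative : Mono n → Set
  HasNegative = Any (λ b → negative b ≡ true)

  compatible-with-cone : ∀ {k σ} → All (IsAlmostPositive A) σ →
                         All (Compatible (negSimple k)) (positives σ) → All (Compatible (negSimple k)) σ
  compatible-with-cone [] [] = []
  compatible-with-cone {k} {b ∷ σ} (ap ∷ aps) fits with nonNeg b in nb
  ... | true  = All.head fits ∷ compatible-with-cone aps (All.tail fits)
  ... | false = subst (Compatible (negSimple k)) (sym b≡-αj) (negSimple-compatible k j , negSimple-compatible j k)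
                ∷ compatible-with-cone aps fits
    where
    j = proj₁ (negative-almostPositive ap (cong not nb))
    b≡-αj = proj₂ (negative-almostPositive ap (cong not nb))

  cone-fitting : ∀ {σ} → Cone σ → HasNegative σ → Fitting (positives σ)
  cone-fitting (aps , _ , compatible) has-negative =
    lose (∈-allFin j) (subst (All (Compatible (negSimple j))) (sym (positives-removal-negative r))
                             (AllP.filter⁺ _ (subst (λ b → All (Compatible b) τ) b≡-αj
                                                    (removed-related Compatible-sym r compatible))))
    where
    τ = proj₁ (removal-of-Any has-negative)
    r = proj₂ (removal-of-Any has-negative)
    j = proj₁ (negative-almostPositive (removed-All r aps) (removed-satisfies r))
    b≡-αj = proj₂ (negative-almostPositive (removed-All r aps) (removed-satisfies r))

  projection-fitting : ∀ {P} (D : Dec (Fitting P)) → Fitting P → ∀ σ → projection D σ ≡ []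
  projection-fitting (yes _)     _    _ = refl
  projection-fitting (no ¬fits) fits _ = ⊥-elim (¬fits fits)

  h-removal : ∀ {σ τ} → Removal negative σ τ → h τ ≡ contraction (fitting? (positives σ)) τ
  h-removal {τ = τ} r = cong (λ P → contraction (fitting? P) τ) (sym (positives-removal-negative r))

  π-removal : ∀ {σ τ} → Removal negative σ τ → π τ ≡ projection (fitting? (positives σ)) τ
  π-removal {τ = τ} r = cong (λ P → projection (fitting? P) τ) (sym (positives-removal-negative r))

  homotopy-for : ∀ {P} (D : Dec (Fitting P)) σ → Sorted σ →
    d₋ (contraction D σ) ++ (extend (contraction D) (∂ negative σ) ++ projection D σ) ≋ ⟦ σ ⟧
  homotopy-for (yes fits) σ sorted = begin
    d₋ (wedge a σ) ++ (extend (wedge a) (∂ negative σ) ++ [])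
      ≈⟨ ++-congˡ (d₋ (wedge a σ)) (++-identityʳ (extend (wedge a) (∂ negative σ))) ⟩
    d₋ (wedge a σ) ++ extend (wedge a) (∂ negative σ)
      ≈⟨ ∂-wedge negative a σ sorted ⟩
    onlyIf (negative a) ⟦ σ ⟧
      ≡⟨ cong (λ t → onlyIf t ⟦ σ ⟧) (negative-negSimple k) ⟩
    ⟦ σ ⟧ ∎
    where
    open ≋-Reasoning
    k = proj₁ (satisfied fits)
    a = negSimple k
  homotopy-for (no _) σ _ = ≡⇒≋ (cong (_++ ⟦ σ ⟧) (extend-const-[] (∂ negative σ)))

  homotopy-mono : ∀ σ → Sorted σ → d₋ (h σ) ++ (extend h (∂ negative σ) ++ π σ) ≋ ⟦ σ ⟧
  homotopy-mono σ sorted = begin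
    d₋ (h σ) ++ (extend h (∂ negative σ) ++ π σ)
      ≈⟨ ++-congˡ (d₋ (h σ)) (++-cong h-on-faces ≋-refl) ⟩
    d₋ (h σ) ++ (extend (contraction D) (∂ negative σ) ++ π σ)
      ≈⟨ homotopy-for D σ sorted ⟩
    ⟦ σ ⟧ ∎
    where
    open ≋-Reasoning
    D = fitting? (positives σ)
    h-on-faces : extend h (∂ negative σ) ≋ extend (contraction D) (∂ negative σ)
    h-on-faces = extend-cong-on (∂ negative σ) (All.map (≡⇒≋ ∘ h-removal) (∂-removals negative σ))

  homotopy : ∀ x → IsChain A c x → d₋ (extend h x) ++ (extend h (d₋ x) ++ extend π x) ≋ x
  homotopy x cones = begin
    d₋ (extend h x) ++ (extend h (d₋ x) ++ extend π x)
      ≈⟨ ++-cong (extend-∘ (∂ negative) h x) (++-cong (extend-∘ h (∂ negative) x) ≋-refl) ⟩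
    extend (λ σ → d₋ (h σ)) x ++ (extend (λ σ → extend h (∂ negative σ)) x ++ extend π x)
      ≈⟨ ++-cong ≋-refl (extend-+ _ π x) ⟨
    extend (λ σ → d₋ (h σ)) x ++ extend (λ σ → extend h (∂ negative σ) ++ π σ) x
      ≈⟨ extend-+ _ _ x ⟨
    extend (λ σ → d₋ (h σ) ++ (extend h (∂ negative σ) ++ π σ)) x
      ≈⟨ extend-cong-on x (All.map (λ cone → homotopy-mono _ (proj₁ (proj₂ cone))) cones) ⟩
    extend ⟦_⟧ x
      ≈⟨ extend-⟦⟧ x ⟩
    x ∎
    where open ≋-Reasoning

  π-HasNegative : ∀ {σ} → Cone σ → HasNegative σ → π σ ≡ []
  π-HasNegative {σ} cone has-negative = projection-fitting (fitting? (positives σ)) (cone-fitting cone has-negative) σ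

  π∂[]-negative : ∀ x → IsChain A c x → extend π (d₋ x) ≋ []
  π∂[]-negative x cones = begin
    extend π (d₋ x)              ≈⟨ extend-∘ π (∂ negative) x ⟩
    extend (λ σ → extend π (∂ negative σ)) x ≈⟨ extend-cong-on x (All.map on-faces cones) ⟩
    extend (λ _ → []) x                     ≡⟨ extend-const-[] x ⟩
    []                                      ∎
    where
    open ≋-Reasoning
    on-faces : ∀ {σ} → Cone σ → extend π (∂ negative σ) ≋ []
    on-faces {σ} cone = ≋-trans (extend-cong-on (∂ negative σ) (All.map vanishes (∂-removals negative σ)))
                                (≡⇒≋ (extend-const-[] (∂ negative σ)))
      where
      vanishes : ∀ {τ} → Removal negative σ τ → π τ ≋ []
      vanishes {τ} r = ≡⇒≋ (trans (π-removal r)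
        (projection-fitting (fitting? (positives σ)) (cone-fitting cone (Removal⇒Any r)) τ))

  h-cones : ∀ {σ} → Cone σ →
            All (λ q → Cone (proj₂ q) × posCount (proj₂ q) ≡ posCount σ × HasNegative (proj₂ q)) (h σ)
  h-cones {σ} (aps , sorted , compatible) with fitting? (positives σ)
  ... | no _     = []
  ... | yes fits = All.map extended (wedge-sorted a σ sorted)
    where
    k = proj₁ (satisfied fits)
    a = negSimple k
    a-compatible : All (Compatible a) σ
    a-compatible = compatible-with-cone aps (proj₂ (satisfied fits))
    extended : ∀ {μ} → Sorted μ × μ ↭ a ∷ σ → Cone μ × posCount μ ≡ posCount σ × HasNegative μ
    extended (sorted-μ , μ↭) =
      (All-resp-↭ (↭-sym μ↭) (inj₂ (k , refl) ∷ aps) , sorted-μ ,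
       AllPairs-resp-↭ Compatible-sym (↭-sym μ↭) (a-compatible ∷ compatible)) ,
      trans (posCount-↭ μ↭) (cong length (positives-removal-negative {σ = a ∷ σ} (here (negative-negSimple k)))) ,
      Any-resp-↭ (↭-sym μ↭) (here (negative-negSimple k))

  module ZigZag (p : ℤ) (w₀ : Chain n)
                (w₀-cones : All (λ e → Cone (proj₂ e) × + posCount (proj₂ e) ≡ p) w₀)
                (d₋w₀≋0 : d₋ w₀ ≋ []) (πd₊w₀≋0 : extend π (d₊ w₀) ≋ []) where

    Layer : ℕ → Mono n → Set
    Layer k m = Cone m × + (k ℕ.+ posCount m) ≡ p

    w : ℕ → Chain n
    w zero    = w₀
    w (suc k) = neg (extend h (d₊ (w k)))

    d₊-Layer : ∀ k {y} → All (Layer k ∘ proj₂) y → All (Layer (suc k) ∘ proj₂) (d₊ y)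
    d₊-Layer k {y} layer =
      All-extend (∂ nonNeg) y (All.map (λ {e} l → All.map (face l) (∂-removals nonNeg (proj₂ e))) layer)
      where
      face : ∀ {σ τ} → Layer k σ → Removal nonNeg σ τ → Layer (suc k) τ
      face (cone , grade) r = Removal-Cone r cone ,
        trans (cong +_ (trans (sym (ℕP.+-suc k _)) (cong (k ℕ.+_) (sym (posCount-removal-nonNeg r))))) grade

    h-Layer : ∀ k {y} → All (Layer k ∘ proj₂) y → All (λ e → Layer k (proj₂ e) × HasNegative (proj₂ e)) (extend h y)
    h-Layer k {y} layer = All-extend h y (All.map (λ (cone , grade) → All.map (λ (cone′ , pc , neg′) →
      (cone′ , trans (cong (λ a → + (k ℕ.+ a)) pc) grade) , neg′) (h-cones cone)) layer)

    layers : ∀ k → All (Layer k ∘ proj₂) (w k)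
    layers zero    = w₀-cones
    layers (suc k) = All-neg (All.map proj₁ (h-Layer (suc k) (d₊-Layer k (layers k))))

    negatives : ∀ k → All (HasNegative ∘ proj₂) (w (suc k))
    negatives k = All-neg (All.map proj₂ (h-Layer (suc k) (d₊-Layer k (layers k))))

    πd₊w≋0 : ∀ k → extend π (d₊ (w k)) ≋ []
    πd₊w≋0 zero    = πd₊w₀≋0
    πd₊w≋0 (suc k) = ≋-trans (extend-cong-on (d₊ (w (suc k))) (All.map (≡⇒≋ ∘ uncurry π-HasNegative) faces))
                             (≡⇒≋ (extend-const-[] (d₊ (w (suc k)))))
      where
      nonNeg⇒¬negative : ∀ {b} → nonNeg b ≡ true → ¬ negative b ≡ true
      nonNeg⇒¬negative nb negb with () ← trans (sym (cong not nb)) negb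
      face : ∀ {σ τ} → Cone σ × HasNegative σ → Removal nonNeg σ τ → Cone τ × HasNegative τ
      face (cone , has-negative) r = Removal-Cone r cone , Removal-Any r (λ {b} → nonNeg⇒¬negative {b}) has-negative
      faces : All (λ e → Cone (proj₂ e) × HasNegative (proj₂ e)) (d₊ (w (suc k)))
      faces = All-extend (∂ nonNeg) (w (suc k))
        (All.zipWith (λ (layer , has-negative) → All.map (face (proj₁ layer , has-negative)) (∂-removals nonNeg _))
                     (layers (suc k) , negatives k))

    mutual
      d₊d₋w≋0 : ∀ k → d₊ (d₋ (w k)) ≋ []
      d₊d₋w≋0 zero    = extend-resp (∂ nonNeg) d₋w₀≋0
      d₊d₋w≋0 (suc k) = begin
        d₊ (d₋ (w (suc k)))   ≈⟨ extend-resp (∂ nonNeg) (d₋w-step k) ⟩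
        d₊ (neg (d₊ (w k)))   ≈⟨ extend-neg (∂ nonNeg) (d₊ (w k)) ⟩
        neg (d₊ (d₊ (w k)))   ≈⟨ neg-cong (∂[]²≋[] nonNeg (w k)) ⟩
        []                    ∎
        where open ≋-Reasoning

      d₋w-step : ∀ k → d₋ (w (suc k)) ≋ neg (d₊ (w k))
      d₋w-step k = begin
        d₋ (neg (extend h y))                              ≈⟨ extend-neg (∂ negative) (extend h y) ⟩
        neg (d₋ (extend h y))                              ≈⟨ neg-cong (++-identityʳ _) ⟨
        neg (d₋ (extend h y) ++ [])
          ≈⟨ neg-cong (++-congˡ (d₋ (extend h y)) (++-cong h-of-d₋ (πd₊w≋0 k))) ⟨
        neg (d₋ (extend h y) ++ (extend h (d₋ y) ++ extend π y))
          ≈⟨ neg-cong (homotopy y (All.map proj₁ (d₊-Layer k (layers k)))) ⟩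
        neg y                                              ∎
        where
        open ≋-Reasoning
        y = d₊ (w k)
        h-of-d₋ : extend h (d₋ y) ≋ []
        h-of-d₋ = begin
          extend h (d₋ (d₊ (w k)))        ≈⟨ extend-resp h (∂[]∂[]≋-neg negative nonNeg (w k)) ⟩
          extend h (neg (d₊ (d₋ (w k))))  ≈⟨ extend-resp h (neg-cong (d₊d₋w≋0 k)) ⟩
          extend h []                     ∎

    lower : ℕ → Chain n
    lower zero    = []
    lower (suc k) = lower k ++ w (suc k)

    d-telescope : ∀ k → d (w₀ ++ lower k) ≋ d₊ (w k)
    d-telescope zero = begin
      d (w₀ ++ [])     ≈⟨ extend-resp dMono (++-identityʳ w₀) ⟩
      d w₀             ≈⟨ d-split nonNeg w₀ ⟩
      d₊ w₀ ++ d₋ w₀   ≈⟨ ++-congˡ (d₊ w₀) d₋w₀≋0 ⟩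
      d₊ w₀ ++ []      ≈⟨ ++-identityʳ (d₊ w₀) ⟩
      d₊ w₀            ∎
      where open ≋-Reasoning
    d-telescope (suc k) = begin
      d (w₀ ++ (lower k ++ w (suc k)))                 ≡⟨ cong d (ListP.++-assoc w₀ (lower k) (w (suc k))) ⟨
      d ((w₀ ++ lower k) ++ w (suc k))                 ≡⟨ extend-++ dMono (w₀ ++ lower k) (w (suc k)) ⟩
      d (w₀ ++ lower k) ++ d (w (suc k))               ≈⟨ ++-cong (d-telescope k) (d-split nonNeg (w (suc k))) ⟩
      d₊ (w k) ++ (d₊ (w (suc k)) ++ d₋ (w (suc k)))
        ≈⟨ ++-congˡ (d₊ (w k)) (++-congˡ (d₊ (w (suc k))) (d₋w-step k)) ⟩
      d₊ (w k) ++ (d₊ (w (suc k)) ++ neg (d₊ (w k)))   ≈⟨ ++-cancel-neg (d₊ (w k)) (d₊ (w (suc k))) ⟩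
      d₊ (w (suc k))                                   ∎
      where open ≋-Reasoning

    top-layer : d₊ (w (clamp p)) ≋ []
    top-layer = ≋-trans (extend-cong-on (w (clamp p)) (All.map no-positives (layers (clamp p))))
                        (≡⇒≋ (extend-const-[] (w (clamp p))))
      where
      no-positives : ∀ {σ} → Layer (clamp p) σ → ∂ nonNeg σ ≋ []
      no-positives {σ} (_ , grade) = ≡⇒≋ (∂-nonNeg-posCount-0 σ (posCount-in-top-layer p _ grade))

    lower-bounded : ∀ k → All (λ e → Cone (proj₂ e) × + posCount (proj₂ e) ℤ.≤ p - 1ℤ) (lower k)
    lower-bounded zero    = []
    lower-bounded (suc k) = AllP.++⁺ (lower-bounded k) (All.map below-p (layers (suc k)))
      where
      below-p : ∀ {σ} → Layer (suc k) σ → Cone σ × + posCount σ ℤ.≤ p - 1ℤ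
      -- p - 1ℤ = + (suc k + posCount σ) - 1ℤ computes to + (k + posCount σ)
      below-p {σ} (cone , grade) =
        cone , subst (λ q → + posCount σ ℤ.≤ q - 1ℤ) grade (ℤ.+≤+ (ℕP.m≤n+m (posCount σ) k))

  extend-to-cycle : ∀ p w₀ → All (λ e → Cone (proj₂ e) × + posCount (proj₂ e) ≡ p) w₀ →
                    d₋ w₀ ≋ [] → extend π (d₊ w₀) ≋ [] →
                    Σ (Chain n) λ t → All (λ e → Cone (proj₂ e) × + posCount (proj₂ e) ℤ.≤ p - 1ℤ) t ×
                                      d (w₀ ++ t) ≋ []
  extend-to-cycle p w₀ cones d₋w₀≋0 πd₊w₀≋0 =
    lower (clamp p) , lower-bounded (clamp p) , ≋-trans (d-telescope (clamp p)) top-layer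
    where open ZigZag p w₀ cones d₋w₀≋0 πd₊w₀≋0

  π-top-column : ∀ p x → IsChain A c x → InF (p - + 2) (d x) → extend π (d₊ (column p x)) ≋ []
  π-top-column p x x-chain dx∈Fp-2 = begin
    extend π (d₊ (column p x))                ≈⟨ extend-resp π (d₊-top-column p x dx∈Fp-2) ⟩
    extend π (neg (d₋ (column (p - 1ℤ) x)))   ≈⟨ extend-neg π (d₋ (column (p - 1ℤ) x)) ⟩
    neg (extend π (d₋ (column (p - 1ℤ) x)))   ≈⟨ neg-cong (π∂[]-negative _ (restrict-keeps (inColumn? (p - 1ℤ)) x-chain)) ⟩
    []                                        ∎
    where open ≋-Reasoning

  boundary-from-lower-filtration : ∀ p x → IsChain A c x → InF p x → InF (p - + 2) (d x) →
                                   Σ (Chain n) λ z → IsChain A c z × InF (p - 1ℤ) z × d z ≋ d x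
  boundary-from-lower-filtration p x x-chain x∈Fp dx∈Fp-2 = z , z-chain , z∈F , dz≋dx
    where
    x₀ = column p x
    cycle = extend-to-cycle p x₀ (All.zip (restrict-keeps (inColumn? p) x-chain , restrict-All (inColumn? p) x))
                            (d₋-top-column p x x∈Fp dx∈Fp-2) (π-top-column p x x-chain dx∈Fp-2)
    t = proj₁ cycle
    t-bounded = proj₁ (proj₂ cycle)

    z : Chain n
    z = below (p - 1ℤ) x ++ neg t

    z-chain : IsChain A c z
    z-chain = AllP.++⁺ (restrict-keeps (atMost? (p - 1ℤ)) x-chain) (All-neg (All.map proj₁ t-bounded))

    z∈F : InF (p - 1ℤ) z
    z∈F = InF-of-All z (AllP.++⁺ (restrict-All (atMost? (p - 1ℤ)) x) (All-neg (All.map proj₂ t-bounded)))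

    dz≋dx : d z ≋ d x
    dz≋dx = begin
      d (below (p - 1ℤ) x ++ neg t)       ≡⟨ extend-++ dMono (below (p - 1ℤ) x) (neg t) ⟩
      d (below (p - 1ℤ) x) ++ d (neg t)   ≈⟨ ++-congˡ (d (below (p - 1ℤ) x)) (extend-neg dMono t) ⟩
      d (below (p - 1ℤ) x) ++ neg (d t)   ≈⟨ ++-congˡ (d (below (p - 1ℤ) x)) d-x₀≋-d-t ⟨
      d (below (p - 1ℤ) x) ++ d x₀        ≡⟨ extend-++ dMono (below (p - 1ℤ) x) x₀ ⟨
      d (below (p - 1ℤ) x ++ x₀)          ≈⟨ extend-resp dMono (InF-split p x x∈Fp) ⟨
      d x                                 ∎
      where
      open ≋-Reasoning
      d-x₀≋-d-t : d x₀ ≋ neg (d t)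
      d-x₀≋-d-t = ≋-neg-of-sum (≋-trans (≡⇒≋ (sym (extend-++ dMono x₀ t))) (proj₂ (proj₂ cycle)))

negSimples-compatible : ∀ {n} {A : CartanMatrix n} {ε c} → IsCompatibilityDegree A ε c →
                        ∀ i j → c (negSimple i) (negSimple j) ≡ 0
negSimples-compatible (degree-from-negSimple , _) i j =
  trans (degree-from-negSimple i (negSimple j) (inj₂ (j , refl))) (clamp-negSimple j i)

proposition7 : ∀ (n : ℕ) (A : CartanMatrix n) → 1 ≤ n →
    IsFiniteTypeCartan n A → IsIndecomposable n A →
    ∀ (ε : Fin n → Bool) → IsBipartition A ε →
    ∀ (c : Root n → Root n → ℕ) → IsCompatibilityDegree A ε c →
    DegeneratesAtE2 A c
proposition7 n A _ _ _ ε _ c degree (suc (suc r)) (s≤s (s≤s _)) p x (x-chain , x∈Fp , dx∈Fp-r) =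
  [] , z , ([] , InF-[] , InF-[]) , (z-chain , z∈Fp-1 , dz∈F) , λ l → sym (coeff-≡ dz≋dx l)
  where
  dx∈Fp-2 : InF (p - + 2) (d x)
  dx∈Fp-2 = InF-mono {x = d x} (ℤP.+-monoʳ-≤ p (ℤP.neg-mono-≤ (ℤ.+≤+ (s≤s (s≤s z≤n))))) dx∈Fp-r

  lifted = ConeComplex.boundary-from-lower-filtration A c (negSimples-compatible {A = A} {ε} degree) p x x-chain x∈Fp dx∈Fp-2
  z = proj₁ lifted
  z-chain = proj₁ (proj₂ lifted)
  z∈Fp-1 = proj₁ (proj₂ (proj₂ lifted))
  dz≋dx = proj₂ (proj₂ (proj₂ lifted))

  dz∈F : InF (p - 1ℤ - + suc r) (d z)
  dz∈F = subst (λ s → InF s (d z)) (regroup p (+ suc r)) (InF-resp (≋-sym dz≋dx) dx∈Fp-r)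
    where
    regroup : ∀ p u → p - (1ℤ + u) ≡ p - 1ℤ - u
    regroup = solve-∀
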